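{- Let $q=p^r$ with $p$ an odd prime and let $k=2q$. Then the Atkin operator $U_t$ acting on $S^1_k(\Gamma_1(t))$ is diagonalizable over $\mathbb{C}_\infty$.
   Context: Let $A=\mathbb{F}_q[t]$, $F_\infty=\mathbb{F}_q((1/t))$, $\mathbb{C}_\infty$ the completion of an algebraic closure of $F_\infty$, and $\Omega=\mathbb{P}^1(\mathbb{C}_\infty)-\mathbb{P}^1(F_\infty)$ the Drinfeld upper half plane. Let $\Gamma_1(t)=\{\gamma\in GL_2(A):\gamma\equiv\left(\begin{smallmatrix}1&*\\0&1\end{smallmatrix}\right)\pmod t\}$. $S^1_k(\Gamma_1(t))$ is the $\mathbb{C}_\infty$-space of Drinfeld cusp forms of weight $k$ for $\Gamma_1(t)$: rigid analytic $f:\Omega\to\mathbb{C}_\infty$ with $f(\gamma z)(cz+d)^{ -k}=f(z)$ for all $\gamma=\left(\begin{smallmatrix}a&b\\c&d\end{smallmatrix}\right)\in\Gamma_1(t)$, holomorphic and vanishing at all cusps. The Atkin operator is $U_t(f)(z)=\sum_{\beta\in\mathbb{F}_q}f\big(\frac{z+\beta}{t}\big)$ (up to a nonzero normalizing scalar). Via Teitelbaum's isomorphism with harmonic cocycles, $S^1_k(\Gamma_1(t))$ has a basis $c_0,\dots,c_{k-2}$ on which $$U_t(c_j)=-(-t)^{j+1}\binom{k-2-j}{j}c_j-t^{j+1}\sum_{h\neq 0}\left[\binom{k-2-j-h(q-1)}{ -h(q-1)}+(-1)^{j+1}\binom{k-2-j-h(q-1)}{j}\right]c_{j+h(q-1)},$$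 with $c_i=0$ for $i\notin[0,k-2]$, binomial coefficients reduced into $\mathbb{F}_p\subset\mathbb{C}_\infty$ and $\binom{n}{m}=0$ if $m<0$ or $m>n$. -}

module Defs where

open import Level using (Level)
open import Data.Nat as ℕ using (ℕ; zero; suc; _∸_; _≤ᵇ_; _≡ᵇ_)
open import Data.Nat.Divisibility using (_∣_; _∣?_)
open import Data.Nat.Combinatorics using (_C_)
open import Data.Fin using (Fin; toℕ)
open import Data.List using (List; []; _∷_)
open import Data.Bool using (if_then_else_)
open import Data.Product using (Σ; ∃; _×_)
open import Data.List.Relation.Unary.Any using (Any)
open import Relation.Nullary using (¬_; does)
open import Algebra.Bundles using (CommutativeRing)

module _ {c ℓ : Level} (K : CommutativeRing c ℓ) where
  open CommutativeRing K

  cast : ℕ → Carrier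
  cast zero = 0#
  cast (suc n) = 1# + cast n

  pow : Carrier → ℕ → Carrier
  pow x zero = 1#
  pow x (suc n) = x * pow x n

  sumFin : (n : ℕ) → (Fin n → Carrier) → Carrier
  sumFin zero f = 0#
  sumFin (suc n) f = f Fin.zero + sumFin n (λ i → f (Fin.suc i))

  evalPoly : List Carrier → Carrier → Carrier
  evalPoly [] x = 0#
  evalPoly (a ∷ as) x = a + x * evalPoly as x

  IsField : Set (c Level.⊔ ℓ)
  IsField = (¬ (1# ≈ 0#)) × (∀ x → ¬ (x ≈ 0#) → ∃ λ y → x * y ≈ 1#)

  IsAlgClosed : Set (c Level.⊔ ℓ)
  IsAlgClosed = ∀ (n : ℕ) (a : Fin (suc n) → Carrier) →
    ∃ λ x → (pow x (suc n) + sumFin (suc n) (λ i → a i * pow x (toℕ i))) ≈ 0#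

  -- t is transcendental over the prime field F_p ⊂ K: no polynomial with
  -- coefficients in F_p (represented by naturals), not all ≡ 0 mod p, vanishes at t
  TranscendentalOverFp : ℕ → Carrier → Set ℓ
  TranscendentalOverFp p t = ∀ (cs : List ℕ) → Any (λ m → ¬ (p ∣ m)) cs →
    ¬ (evalPoly (Data.List.map cast cs) t ≈ 0#)

  Mat : ℕ → Set c
  Mat n = Fin n → Fin n → Carrier

  _⊗_ : {n : ℕ} → Mat n → Mat n → Mat n
  _⊗_ {n} A B i j = sumFin n (λ l → A i l * B l j)

  idMat : {n : ℕ} → Mat n
  idMat i j = if does (toℕ i ℕ.≟ toℕ j) then 1# else 0#

  diagMat : {n : ℕ} → (Fin n → Carrier) → Mat n
  diagMat d i j = if does (toℕ i ℕ.≟ toℕ j) then d j else 0#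

  _≈M_ : {n : ℕ} → Mat n → Mat n → Set ℓ
  A ≈M B = ∀ i j → A i j ≈ B i j

  Diagonalizable : {n : ℕ} → Mat n → Set (c Level.⊔ ℓ)
  Diagonalizable {n} A = Σ (Mat n) λ P → Σ (Mat n) λ Q → Σ (Fin n → Carrier) λ d →
    ((P ⊗ Q) ≈M idMat) × ((Q ⊗ P) ≈M idMat) × ((A ⊗ P) ≈M (P ⊗ diagMat d))

  -- Coefficient of c_i in U_t(c_j), for weight k, given q, with 0 ≤ i, j ≤ k-2.
  -- Diagonal (h = 0):  -(-t)^(j+1) C(k-2-j, j).
  -- Off-diagonal, i = j + h(q-1), h ≠ 0:
  --   -t^(j+1) [ C(k-2-i, j-i) + (-1)^(j+1) C(k-2-i, j) ]
  -- (using k-2-j-h(q-1) = k-2-i, -h(q-1) = j-i; C(n,m)=0 for m<0 or m>n).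
  -- Binomials are mapped into F_p ⊂ K via cast (K has characteristic p).
  binomZ : ℕ → ℕ → ℕ → ℕ
  binomZ n i j = if i ≤ᵇ j then n C (j ∸ i) else 0

  absDiff : ℕ → ℕ → ℕ
  absDiff i j = (i ∸ j) ℕ.+ (j ∸ i)

  UtEntry : (q k : ℕ) → Carrier → ℕ → ℕ → Carrier
  UtEntry q k t i j =
    if i ≡ᵇ j
    then - (pow (- t) (suc j) * cast ((k ∸ 2 ∸ j) C j))
    else (if does ((q ∸ 1) ∣? absDiff i j)
          then - (pow t (suc j) *
                   (cast (binomZ (k ∸ 2 ∸ i) i j)
                    + pow (- 1#) (suc j) * cast ((k ∸ 2 ∸ i) C j)))
          else 0#)

  -- Matrix of U_t on S^1_k(Γ_1(t)) in the basis c_0,…,c_{k-2} (size k-1):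
  -- column j holds the coordinates of U_t(c_j).
  UtMatrix : (q k : ℕ) → Carrier → Mat (k ∸ 1)
  UtMatrix q k t i j = UtEntry q k t (toℕ i) (toℕ j)

module Submission where

-- Write m = q - 1 (even, since q is odd), so the matrix of U_t has size k - 1 = 2m + 1.
-- Its (i, j) entry vanishes unless i ≡ j (mod m); grouping indices by residue mod m makes the
-- matrix block diagonal, with one 3×3 block for the class of 0 (indices 0, m, 2m) and one 2×2
-- block for every other class a (indices a, a + m). Modulo p, the Lucas congruence
-- C(q + u, v) ≡ C(u, v) + C(u, v - q) computes all block entries as powers of t times small
-- binomial coefficients. The 3×3 block has the distinct eigenvalues t, t^(m+1), 0. A 2×2 block
-- is diagonal, triangular with distinct diagonal entries, or has nonzero lower-left entry and
-- nonzero discriminant; the last uses that t is transcendental over F_p.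

open import Defs
open import Level using (Level; _⊔_)
open import Algebra.Bundles using (CommutativeRing)
import Algebra.Solver.Ring
import Algebra.Solver.Ring.AlmostCommutativeRing as ACR
open import Data.Bool as Bool using (Bool; true; false; if_then_else_)
open import Data.Fin as Fin using (Fin; toℕ)
open import Data.Fin.Properties using (toℕ<n)
open import Data.Integer as ℤ using (ℤ; +_; -[1+_])
import Data.Integer.Properties as ℤP
open import Data.List as List using (List; []; _∷_; _++_; replicate)
open import Data.List.Relation.Unary.All using (All; []; _∷_)
open import Data.List.Relation.Unary.Any using (Any; here; there)
import Data.List.Relation.Unary.Any.Properties as AnyP
open import Data.Maybe using (Maybe; just; nothing)
open import Data.Nat as ℕ using (ℕ; zero; suc; z≤n; s≤s; _≡ᵇ_; _≤ᵇ_; NonZero)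
open import Data.Nat.Combinatorics using (_C_; nCk+nC[k+1]≡[n+1]C[k+1]; k>n⇒nCk≡0; nCn≡1)
open import Data.Nat.Divisibility using (_∣_; _∣?_; divides; ∣m+n∣m⇒∣n; ∣m∣n⇒∣m+n)
open import Data.Nat.DivMod using (_%_; _/_; m≡m%n+[m/n]*n; [m+kn]%n≡m%n; m<n⇒m%n≡m; m%n<n)
open import Data.Nat.Primality using (Prime; prime⇒nonZero)
import Data.Nat.Properties as ℕP
open import Data.Product using (∃; _,_; proj₁; proj₂)
open import Data.Sign as Sign using (Sign)
open import Data.Sum using (_⊎_; inj₁; inj₂; [_,_]′)
open import Data.Unit using (tt)
import Data.Vec as Vec
open import Relation.Binary.PropositionalEquality as Eq using (_≡_; _≢_)
open import Relation.Nullary using (¬_; yes; no; does; contradiction)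
open import Relation.Nullary.Decidable using (dec-true; dec-false)

module RingFacts {c ℓ : Level} (K : CommutativeRing c ℓ) where
  open CommutativeRing K
  open import Relation.Binary.Reasoning.Setoid setoid
  open import Algebra.Properties.Ring ring public
  open import Algebra.Properties.CommutativeSemigroup +-commutativeSemigroup
    using () renaming (interchange to +-interchange) public
  open import Algebra.Properties.CommutativeSemigroup *-commutativeSemigroup
    using () renaming (interchange to *-interchange) public

  cast-+ : ∀ m n → cast K (m ℕ.+ n) ≈ cast K m + cast K n
  cast-+ zero n = sym (+-identityˡ _)
  cast-+ (suc m) n = trans (+-congˡ (cast-+ m n)) (sym (+-assoc _ _ _))

  cast-* : ∀ m n → cast K (m ℕ.* n) ≈ cast K m * cast K n
  cast-* zero n = sym (zeroˡ _)
  cast-* (suc m) n = begin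
    cast K (n ℕ.+ m ℕ.* n)          ≈⟨ cast-+ n (m ℕ.* n) ⟩
    cast K n + cast K (m ℕ.* n)     ≈⟨ +-cong (sym (*-identityˡ _)) (cast-* m n) ⟩
    1# * cast K n + cast K m * cast K n ≈⟨ sym (distribʳ _ _ _) ⟩
    (1# + cast K m) * cast K n      ∎

  -- ℕ → K with 1 ↦ 1# on the nose, so that the solver's constant 1 is definitionally 1#.
  ofℕ : ℕ → Carrier
  ofℕ zero = 0#
  ofℕ (suc zero) = 1#
  ofℕ (suc (suc n)) = 1# + ofℕ (suc n)

  ofℕ≈cast : ∀ n → ofℕ n ≈ cast K n
  ofℕ≈cast zero = refl
  ofℕ≈cast (suc zero) = sym (+-identityʳ 1#)
  ofℕ≈cast (suc (suc n)) = +-congˡ (ofℕ≈cast (suc n))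

  castℤ : ℤ → Carrier
  castℤ (+ n) = ofℕ n
  castℤ -[1+ n ] = - ofℕ (suc n)

  private
    -- castℤ described through cast, where the homomorphism laws are proved
    castℤ′ : ℤ → Carrier
    castℤ′ (+ n) = cast K n
    castℤ′ -[1+ n ] = - cast K (suc n)

    castℤ≈castℤ′ : ∀ i → castℤ i ≈ castℤ′ i
    castℤ≈castℤ′ (+ n) = ofℕ≈cast n
    castℤ≈castℤ′ -[1+ n ] = -‿cong (ofℕ≈cast (suc n))

    signed : Sign → Carrier
    signed Sign.+ = 1#
    signed Sign.- = - 1#

    castℤ′-◃ : ∀ s n → castℤ′ (s ℤ.◃ n) ≈ signed s * cast K n
    castℤ′-◃ s zero = sym (zeroʳ _)
    castℤ′-◃ Sign.+ (suc n) = sym (*-identityˡ _)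
    castℤ′-◃ Sign.- (suc n) = sym (-1*x≈-x _)

    castℤ′-signAbs : ∀ i → castℤ′ i ≈ signed (ℤ.sign i) * cast K ℤ.∣ i ∣
    castℤ′-signAbs (+ n) = sym (*-identityˡ _)
    castℤ′-signAbs -[1+ n ] = sym (-1*x≈-x _)

    signed-* : ∀ s s' → signed (s Sign.* s') ≈ signed s * signed s'
    signed-* Sign.+ s' = sym (*-identityˡ _)
    signed-* Sign.- Sign.+ = sym (*-identityʳ _)
    signed-* Sign.- Sign.- = begin
      1#            ≈⟨ sym (-‿involutive 1#) ⟩
      - - 1#        ≈⟨ -‿cong (sym (-1*x≈-x 1#)) ⟩
      - (- 1# * 1#) ≈⟨ -‿distribʳ-* (- 1#) 1# ⟩
      - 1# * - 1#   ∎

    castℤ′-⊖ : ∀ m n → castℤ′ (m ℤ.⊖ n) ≈ cast K m - cast K n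
    castℤ′-⊖ m zero = sym (trans (+-congˡ -0#≈0#) (+-identityʳ _))
    castℤ′-⊖ zero (suc n) = sym (+-identityˡ _)
    castℤ′-⊖ (suc m) (suc n) = begin
      castℤ′ (suc m ℤ.⊖ suc n)                  ≡⟨ Eq.cong castℤ′ (ℤP.[1+m]⊖[1+n]≡m⊖n m n) ⟩
      castℤ′ (m ℤ.⊖ n)                          ≈⟨ castℤ′-⊖ m n ⟩
      cast K m - cast K n                       ≈⟨ sym (+-identityˡ _) ⟩
      0# + (cast K m - cast K n)                ≈⟨ +-congʳ (sym (-‿inverseʳ 1#)) ⟩
      (1# - 1#) + (cast K m - cast K n)         ≈⟨ +-interchange _ _ _ _ ⟩
      (1# + cast K m) + (- 1# - cast K n)       ≈⟨ +-congˡ (-‿+-comm 1# (cast K n)) ⟩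
      (1# + cast K m) - (1# + cast K n)         ∎

    castℤ′-+ : ∀ i j → castℤ′ (i ℤ.+ j) ≈ castℤ′ i + castℤ′ j
    castℤ′-+ -[1+ m ] -[1+ n ] = begin
      - (1# + cast K (suc (m ℕ.+ n)))          ≈⟨ -‿cong (+-congˡ (+-congˡ (cast-+ m n))) ⟩
      - (1# + (1# + (cast K m + cast K n)))    ≈⟨ -‿cong (+-congˡ (sym (+-assoc _ _ _))) ⟩
      - (1# + ((1# + cast K m) + cast K n))    ≈⟨ -‿cong (+-congˡ (+-comm _ _)) ⟩
      - (1# + (cast K n + (1# + cast K m)))    ≈⟨ -‿cong (sym (+-assoc _ _ _)) ⟩
      - ((1# + cast K n) + (1# + cast K m))    ≈⟨ -‿cong (+-comm _ _) ⟩
      - ((1# + cast K m) + (1# + cast K n))    ≈⟨ sym (-‿+-comm _ _) ⟩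
      - (1# + cast K m) + - (1# + cast K n)    ∎
    castℤ′-+ -[1+ m ] (+ n) = trans (castℤ′-⊖ n (suc m)) (+-comm _ _)
    castℤ′-+ (+ m) -[1+ n ] = castℤ′-⊖ m (suc n)
    castℤ′-+ (+ m) (+ n) = cast-+ m n

    castℤ′-* : ∀ i j → castℤ′ (i ℤ.* j) ≈ castℤ′ i * castℤ′ j
    castℤ′-* i j = begin
      castℤ′ ((ℤ.sign i Sign.* ℤ.sign j) ℤ.◃ (ℤ.∣ i ∣ ℕ.* ℤ.∣ j ∣))
        ≈⟨ castℤ′-◃ (ℤ.sign i Sign.* ℤ.sign j) (ℤ.∣ i ∣ ℕ.* ℤ.∣ j ∣) ⟩
      signed (ℤ.sign i Sign.* ℤ.sign j) * cast K (ℤ.∣ i ∣ ℕ.* ℤ.∣ j ∣)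
        ≈⟨ *-cong (signed-* (ℤ.sign i) (ℤ.sign j)) (cast-* ℤ.∣ i ∣ ℤ.∣ j ∣) ⟩
      (signed (ℤ.sign i) * signed (ℤ.sign j)) * (cast K ℤ.∣ i ∣ * cast K ℤ.∣ j ∣)
        ≈⟨ *-interchange _ _ _ _ ⟩
      (signed (ℤ.sign i) * cast K ℤ.∣ i ∣) * (signed (ℤ.sign j) * cast K ℤ.∣ j ∣)
        ≈⟨ sym (*-cong (castℤ′-signAbs i) (castℤ′-signAbs j)) ⟩
      castℤ′ i * castℤ′ j ∎

    castℤ′-neg : ∀ i → castℤ′ (ℤ.- i) ≈ - castℤ′ i
    castℤ′-neg -[1+ n ] = sym (-‿involutive _)
    castℤ′-neg (+ zero) = sym -0#≈0#
    castℤ′-neg (+ suc n) = refl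

  castℤ-+ : ∀ i j → castℤ (i ℤ.+ j) ≈ castℤ i + castℤ j
  castℤ-+ i j = trans (castℤ≈castℤ′ (i ℤ.+ j))
    (trans (castℤ′-+ i j) (sym (+-cong (castℤ≈castℤ′ i) (castℤ≈castℤ′ j))))

  castℤ-* : ∀ i j → castℤ (i ℤ.* j) ≈ castℤ i * castℤ j
  castℤ-* i j = trans (castℤ≈castℤ′ (i ℤ.* j))
    (trans (castℤ′-* i j) (sym (*-cong (castℤ≈castℤ′ i) (castℤ≈castℤ′ j))))

  castℤ-neg : ∀ i → castℤ (ℤ.- i) ≈ - castℤ i
  castℤ-neg i = trans (castℤ≈castℤ′ (ℤ.- i)) (trans (castℤ′-neg i) (sym (-‿cong (castℤ≈castℤ′ i))))

  castℤ-hom : ℤ.+-*-rawRing ACR.-Raw-AlmostCommutative⟶ ACR.fromCommutativeRing K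
  castℤ-hom = record
    { ⟦_⟧ = castℤ ; +-homo = castℤ-+ ; *-homo = castℤ-* ; -‿homo = castℤ-neg
    ; 0-homo = refl ; 1-homo = refl }

  castℤ-≟ : ∀ i j → Maybe (castℤ i ≈ castℤ j)
  castℤ-≟ i j with i ℤ.≟ j
  ... | yes Eq.refl = just refl
  ... | no _ = nothing

  module Solver = Algebra.Solver.Ring ℤ.+-*-rawRing (ACR.fromCommutativeRing K) castℤ-hom castℤ-≟

  pow-+ : ∀ x a b → pow K x (a ℕ.+ b) ≈ pow K x a * pow K x b
  pow-+ x zero b = sym (*-identityˡ _)
  pow-+ x (suc a) b = trans (*-congˡ (pow-+ x a b)) (sym (*-assoc _ _ _))

  pow-neg : ∀ x n → pow K (- x) n ≈ pow K (- 1#) n * pow K x n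
  pow-neg x zero = sym (*-identityˡ _)
  pow-neg x (suc n) = begin
    - x * pow K (- x) n                          ≈⟨ *-cong (sym (-1*x≈-x x)) (pow-neg x n) ⟩
    (- 1# * x) * (pow K (- 1#) n * pow K x n)     ≈⟨ *-interchange _ _ _ _ ⟩
    (- 1# * pow K (- 1#) n) * (x * pow K x n)     ∎

  pow-minusOne-even : ∀ e → pow K (- 1#) (e ℕ.+ e) ≈ 1#
  pow-minusOne-even zero = refl
  pow-minusOne-even (suc e) = begin
    - 1# * pow K (- 1#) (e ℕ.+ suc e)       ≡⟨ Eq.cong (λ k → - 1# * pow K (- 1#) k) (ℕP.+-suc e e) ⟩
    - 1# * (- 1# * pow K (- 1#) (e ℕ.+ e))  ≈⟨ sym (*-assoc _ _ _) ⟩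
    (- 1# * - 1#) * pow K (- 1#) (e ℕ.+ e)  ≈⟨ *-cong (trans (-1*x≈-x (- 1#)) (-‿involutive 1#)) (pow-minusOne-even e) ⟩
    1# * 1#                                 ≈⟨ *-identityˡ 1# ⟩
    1#                                      ∎

module FieldFacts {c ℓ : Level} (K : CommutativeRing c ℓ) (fld : IsField K) where
  open CommutativeRing K
  open import Relation.Binary.Reasoning.Setoid setoid
  open RingFacts K

  1≉0 : ¬ (1# ≈ 0#)
  1≉0 = proj₁ fld

  inverse : ∀ x → ¬ (x ≈ 0#) → ∃ λ y → x * y ≈ 1#
  inverse = proj₂ fld

  nonzero-* : ∀ {a b} → ¬ (a ≈ 0#) → ¬ (b ≈ 0#) → ¬ (a * b ≈ 0#)
  nonzero-* {a} {b} a≉0 b≉0 ab≈0 with inverse a a≉0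
  ... | a⁻¹ , aa⁻¹≈1 = b≉0 (begin
    b                ≈⟨ sym (*-identityˡ b) ⟩
    1# * b           ≈⟨ *-congʳ (trans (sym aa⁻¹≈1) (*-comm a a⁻¹)) ⟩
    (a⁻¹ * a) * b    ≈⟨ *-assoc a⁻¹ a b ⟩
    a⁻¹ * (a * b)    ≈⟨ *-congˡ ab≈0 ⟩
    a⁻¹ * 0#         ≈⟨ zeroʳ a⁻¹ ⟩
    0#               ∎)

  nonzero-neg : ∀ {a} → ¬ (a ≈ 0#) → ¬ (- a ≈ 0#)
  nonzero-neg {a} a≉0 -a≈0 = a≉0 (trans (sym (-‿involutive a)) (trans (-‿cong -a≈0) -0#≈0#))

  nonzero-pow : ∀ {a} n → ¬ (a ≈ 0#) → ¬ (pow K a n ≈ 0#)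
  nonzero-pow zero a≉0 = 1≉0
  nonzero-pow (suc n) a≉0 = nonzero-* a≉0 (nonzero-pow n a≉0)

module ArithmeticFacts where
  open import Data.Nat
  open import Data.Nat.Properties
  open import Data.Nat.Divisibility
  open import Data.Nat.Primality
  open import Data.Nat.Combinatorics
  open import Data.Nat.Tactic.RingSolver using (solve-∀)
  open import Relation.Binary.PropositionalEquality
  open ≡-Reasoning

  binom-absorb : ∀ n k → suc k * (suc n C suc k) ≡ suc n * (n C k)
  binom-absorb zero zero = refl
  binom-absorb zero (suc k) = begin
    suc (suc k) * (1 C suc (suc k)) ≡⟨ cong (suc (suc k) *_) (k>n⇒nCk≡0 {1} {suc (suc k)} (s≤s (s≤s z≤n))) ⟩
    suc (suc k) * 0                 ≡⟨ *-zeroʳ (suc (suc k)) ⟩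
    0                               ≡⟨ cong (1 *_) (k>n⇒nCk≡0 {0} {suc k} (s≤s z≤n)) ⟨
    1 * (0 C suc k)                 ∎
  binom-absorb (suc n) zero = begin
    1 * (suc (suc n) C 1) ≡⟨ *-identityˡ _ ⟩
    suc (suc n) C 1       ≡⟨ nC1≡n (suc (suc n)) ⟩
    suc (suc n)           ≡⟨ *-identityʳ _ ⟨
    suc (suc n) * 1       ∎
  binom-absorb (suc n) (suc k) = begin
    suc (suc k) * (suc (suc n) C suc (suc k))
      ≡⟨ cong (suc (suc k) *_) (nCk+nC[k+1]≡[n+1]C[k+1] (suc n) (suc k)) ⟨
    suc (suc k) * (A + B)                     ≡⟨ expand (suc k) A B ⟩
    suc k * A + A + suc (suc k) * B           ≡⟨ cong₂ (λ x y → x + A + y) (binom-absorb n k) (binom-absorb n (suc k)) ⟩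
    suc n * (n C k) + A + suc n * (n C suc k) ≡⟨ collect (suc n) (n C k) (n C suc k) A ⟩
    suc n * (n C k + n C suc k) + A           ≡⟨ cong (λ x → suc n * x + A) (nCk+nC[k+1]≡[n+1]C[k+1] n k) ⟩
    suc n * A + A                             ≡⟨ +-comm (suc n * A) A ⟩
    suc (suc n) * A                           ∎
    where
    A B : ℕ
    A = suc n C suc k
    B = suc n C suc (suc k)
    expand : ∀ x a b → suc x * (a + b) ≡ x * a + a + suc x * b
    expand = solve-∀
    collect : ∀ x a b y → x * a + y + x * b ≡ x * (a + b) + y
    collect = solve-∀

  prime∣-cofactor : ∀ {p} → Prime p → ∀ e v c → 0 < v → v < p ^ e → p ^ e ∣ v * c → p ∣ c
  prime∣-cofactor pp zero v c 0<v v<1 _ = contradiction (≤-trans 0<v (≤-pred v<1)) (<-irrefl refl)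
  prime∣-cofactor {p} pp (suc e) v c 0<v v<pe pe∣vc
    with euclidsLemma v c pp (∣-trans (m∣m*n (p ^ e)) pe∣vc)
  ... | inj₂ p∣c = p∣c
  ... | inj₁ p∣v = prime∣-cofactor pp e v′ c 0<v′ v′<pe pe∣v′c
    where
    instance
      p≢0 : NonZero p
      p≢0 = prime⇒nonZero pp
    v′ : ℕ
    v′ = quotient p∣v
    v≡pv′ : v ≡ p * v′
    v≡pv′ = m∣n⇒n≡m*quotient p∣v
    0<v′ : 0 < v′
    0<v′ = n≢0⇒n>0 (λ v′≡0 → <-irrefl (sym (trans v≡pv′ (trans (cong (p *_) v′≡0) (*-zeroʳ p)))) 0<v)
    v′<pe : v′ < p ^ e
    v′<pe = *-cancelˡ-< p v′ (p ^ e) (subst (_< p * p ^ e) v≡pv′ v<pe)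
    pe∣v′c : p ^ e ∣ v′ * c
    pe∣v′c = *-cancelˡ-∣ p (subst (p * p ^ e ∣_) (trans (cong (_* c) v≡pv′) (*-assoc p v′ c)) pe∣vc)

  -- p divides C(p^(r+1), v) for 0 < v < p^(r+1): combine binom-absorb with prime∣-cofactor.
  prime∣binom-primePower : ∀ {p} → Prime p → ∀ r v → 0 < v → v < p ^ suc r → p ∣ (p ^ suc r) C v
  prime∣binom-primePower {p} pp r (suc v) 0<v v<q with p ^ suc r in q≡
  ... | zero = contradiction (≤-trans 0<v (≤-trans (<⇒≤ v<q) z≤n)) (<-irrefl refl)
  ... | suc q = prime∣-cofactor pp (suc r) (suc v) (suc q C suc v) 0<v (subst (suc v <_) (sym q≡) v<q)
         (subst (_∣ suc v * (suc q C suc v)) (sym q≡)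
           (subst (suc q ∣_) (sym (binom-absorb q v)) (m∣m*n (q C v))))

  odd-primePower : ∀ {p} → Prime p → p ≢ 2 → ∀ n → ¬ (2 ∣ p ^ n)
  odd-primePower pp p≢2 zero 2∣1 = contradiction (∣1⇒≡1 2∣1) (λ ())
  odd-primePower {p} pp p≢2 (suc n) 2∣pⁿ⁺¹ with euclidsLemma p (p ^ n) (prime 2-rough) 2∣pⁿ⁺¹
  ... | inj₂ 2∣pⁿ = odd-primePower pp p≢2 n 2∣pⁿ
  ... | inj₁ 2∣p = [ (λ ()) , (λ 2≡p → p≢2 (sym 2≡p)) ]′ (prime⇒irreducible pp 2∣p)

  odd-suc⇒even : ∀ m → ¬ (2 ∣ suc m) → ∃ λ h → m ≡ h + h
  odd-suc⇒even zero _ = 0 , refl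
  odd-suc⇒even (suc zero) 2∤2 = contradiction (divides 1 refl) 2∤2
  odd-suc⇒even (suc (suc m)) 2∤m+3 with odd-suc⇒even m (λ { (divides k e) → 2∤m+3 (divides (suc k) (cong (λ x → suc (suc x)) e)) })
  ... | h , m≡h+h = suc h , trans (cong (λ x → suc (suc x)) m≡h+h) (cong suc (sym (+-suc h h)))

  prime∤-* : ∀ {p x y} → Prime p → ¬ (p ∣ x) → ¬ (p ∣ y) → ¬ (p ∣ x * y)
  prime∤-* pp p∤x p∤y p∣xy = [ p∤x , p∤y ]′ (euclidsLemma _ _ pp p∣xy)

  prime∤1 : ∀ {p} → Prime p → ¬ (p ∣ 1)
  prime∤1 {p} pp p∣1 = <⇒≱ (nonTrivial⇒n>1 p {{prime⇒nonTrivial pp}}) (∣⇒≤ p∣1)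

  odd-prime∤4 : ∀ {p} → Prime p → p ≢ 2 → ¬ (p ∣ 4)
  odd-prime∤4 {p} pp p≢2 = prime∤-* {y = 2} pp p∤2 p∤2
    where
    p∤2 : ¬ (p ∣ 2)
    p∤2 p∣2 = p≢2 (≤-antisym (∣⇒≤ p∣2) (nonTrivial⇒n>1 p {{prime⇒nonTrivial pp}}))

≡ᵇ-refl : ∀ n → (n ≡ᵇ n) ≡ true
≡ᵇ-refl zero = Eq.refl
≡ᵇ-refl (suc n) = ≡ᵇ-refl n

≡ᵇ-true⇒≡ : ∀ {a b} → (a ≡ᵇ b) ≡ true → a ≡ b
≡ᵇ-true⇒≡ {a} {b} e = ℕP.≡ᵇ⇒≡ a b (Eq.subst Bool.T (Eq.sym e) tt)

≡⇒≡ᵇ-true : ∀ {a b} → a ≡ b → (a ≡ᵇ b) ≡ true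
≡⇒≡ᵇ-true {a} Eq.refl = ≡ᵇ-refl a

≢⇒≡ᵇ-false : ∀ {a b} → a ≢ b → (a ≡ᵇ b) ≡ false
≢⇒≡ᵇ-false {a} {b} a≢b with a ≡ᵇ b in e
... | true = contradiction (≡ᵇ-true⇒≡ e) a≢b
... | false = Eq.refl

≡ᵇ-false⇒≢ : ∀ {a b} → (a ≡ᵇ b) ≡ false → a ≢ b
≡ᵇ-false⇒≢ {a} e Eq.refl with () ← Eq.trans (Eq.sym e) (≡ᵇ-refl a)

≤⇒≤ᵇ-true : ∀ {a b} → a ℕ.≤ b → (a ≤ᵇ b) ≡ true
≤⇒≤ᵇ-true {a} {b} a≤b with a ≤ᵇ b | ℕP.≤⇒≤ᵇ a≤b
... | true | _ = Eq.refl

>⇒≤ᵇ-false : ∀ {a b} → b ℕ.< a → (a ≤ᵇ b) ≡ false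
>⇒≤ᵇ-false {a} {b} b<a with a ≤ᵇ b in e
... | true = contradiction (ℕP.≤ᵇ⇒≤ a b (Eq.subst Bool.T (Eq.sym e) tt)) (ℕP.<⇒≱ b<a)
... | false = Eq.refl

boolCase : ∀ {a} {P : Set a} (b : Bool) → (b ≡ true → P) → (b ≡ false → P) → P
boolCase true onTrue onFalse = onTrue Eq.refl
boolCase false onTrue onFalse = onFalse Eq.refl

module ShiftedBinomial (q : ℕ) where
  open import Relation.Binary.Definitions using (tri<; tri≈; tri>)
  open Eq.≡-Reasoning

  shifted : ℕ → ℕ → ℕ
  shifted u v = if q ≤ᵇ v then u C (v ℕ.∸ q) else 0

  shifted-≥ : ∀ u v → q ℕ.≤ v → shifted u v ≡ u C (v ℕ.∸ q)
  shifted-≥ u v q≤v = Eq.cong (λ b → if b then u C (v ℕ.∸ q) else 0) (≤⇒≤ᵇ-true q≤v)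

  shifted-< : ∀ u v → v ℕ.< q → shifted u v ≡ 0
  shifted-< u v v<q = Eq.cong (λ b → if b then u C (v ℕ.∸ q) else 0) (>⇒≤ᵇ-false v<q)

  shifted-pascal : ∀ u v → shifted (suc u) (suc v) ≡ shifted u v ℕ.+ shifted u (suc v)
  shifted-pascal u v with ℕP.<-cmp q (suc v)
  ... | tri< q<1+v _ _ = begin
      shifted (suc u) (suc v)                ≡⟨ shifted-≥ (suc u) (suc v) (ℕP.<⇒≤ q<1+v) ⟩
      suc u C (suc v ℕ.∸ q)                  ≡⟨ Eq.cong (suc u C_) (ℕP.+-∸-assoc 1 q≤v) ⟩
      suc u C suc (v ℕ.∸ q)                  ≡⟨ nCk+nC[k+1]≡[n+1]C[k+1] u (v ℕ.∸ q) ⟨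
      u C (v ℕ.∸ q) ℕ.+ u C suc (v ℕ.∸ q)    ≡⟨ Eq.cong₂ ℕ._+_ (shifted-≥ u v q≤v)
                                                  (Eq.trans (shifted-≥ u (suc v) (ℕP.<⇒≤ q<1+v)) (Eq.cong (u C_) (ℕP.+-∸-assoc 1 q≤v))) ⟨
      shifted u v ℕ.+ shifted u (suc v)      ∎
    where
    q≤v : q ℕ.≤ v
    q≤v = ℕP.≤-pred q<1+v
  ... | tri≈ _ q≡1+v _ = begin
      shifted (suc u) (suc v)                ≡⟨ shifted-≥ (suc u) (suc v) (ℕP.≤-reflexive q≡1+v) ⟩
      suc u C (suc v ℕ.∸ q)                  ≡⟨ Eq.cong (suc u C_) v+1∸q≡0 ⟩
      1                                      ≡⟨ Eq.cong (u C_) v+1∸q≡0 ⟨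
      u C (suc v ℕ.∸ q)                      ≡⟨ shifted-≥ u (suc v) (ℕP.≤-reflexive q≡1+v) ⟨
      shifted u (suc v)                      ≡⟨ Eq.cong (ℕ._+ shifted u (suc v)) (shifted-< u v (ℕP.≤-reflexive (Eq.sym q≡1+v))) ⟨
      shifted u v ℕ.+ shifted u (suc v)      ∎
    where
    v+1∸q≡0 : suc v ℕ.∸ q ≡ 0
    v+1∸q≡0 = Eq.trans (Eq.cong (suc v ℕ.∸_) q≡1+v) (ℕP.n∸n≡0 (suc v))
  ... | tri> _ _ 1+v<q = Eq.trans (shifted-< (suc u) (suc v) 1+v<q)
      (Eq.sym (Eq.cong₂ ℕ._+_ (shifted-< u v (ℕP.<-trans ℕP.≤-refl 1+v<q)) (shifted-< u (suc v) 1+v<q)))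

-- If C(q,v) vanishes in K for all 0 < v < q, then
--   C(q+u, v) = C(u, v) + C(u, v-q)   in K,
-- where C(u, v-q) is read as 0 for v < q.  This is the coefficient form of
-- (1+x)^(q+u) = (1+x^q)(1+x)^u, proved by induction on u via Pascal's rule.
module Lucas {c ℓ : Level} (K : CommutativeRing c ℓ) (q : ℕ) (0<q : 0 ℕ.< q)
  (binom-q-vanishes : ∀ v → 0 ℕ.< v → v ℕ.< q → CommutativeRing._≈_ K (cast K (q C v)) (CommutativeRing.0# K)) where
  open CommutativeRing K
  open import Relation.Binary.Reasoning.Setoid setoid
  open RingFacts K
  open import Relation.Binary.Definitions using (tri<; tri≈; tri>)
  open ShiftedBinomial q

  shifted-zero : ∀ u → cast K (u C 0) ≈ cast K (u C 0) + cast K (shifted u 0)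
  shifted-zero u = trans (sym (+-identityʳ _)) (+-congˡ (reflexive (Eq.cong (cast K) (Eq.sym (shifted-< u 0 0<q)))))

  lucas-base : ∀ v → cast K (q C v) ≈ cast K (0 C v) + cast K (shifted 0 v)
  lucas-base zero = shifted-zero 0
  lucas-base (suc v) with ℕP.<-cmp (suc v) q
  ... | tri< 1+v<q _ _ = begin
      cast K (q C suc v)                           ≈⟨ binom-q-vanishes (suc v) (s≤s z≤n) 1+v<q ⟩
      0#                                           ≈⟨ +-identityˡ 0# ⟨
      0# + 0#                                      ≡⟨ Eq.cong (λ k → 0# + cast K k) (shifted-< 0 (suc v) 1+v<q) ⟨
      cast K (0 C suc v) + cast K (shifted 0 (suc v)) ∎
  ... | tri≈ _ 1+v≡q _ = begin
      cast K (q C suc v)                           ≡⟨ Eq.cong (λ k → cast K (q C k)) 1+v≡q ⟩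
      cast K (q C q)                               ≡⟨ Eq.cong (cast K) (nCn≡1 q) ⟩
      cast K 1                                     ≈⟨ +-identityˡ _ ⟨
      0# + cast K (0 C 0)                          ≡⟨ Eq.cong (λ k → 0# + cast K (0 C k)) (Eq.trans (Eq.cong (ℕ._∸ q) 1+v≡q) (ℕP.n∸n≡0 q)) ⟨
      0# + cast K (0 C (suc v ℕ.∸ q))              ≡⟨ Eq.cong (λ k → 0# + cast K k) (shifted-≥ 0 (suc v) (ℕP.≤-reflexive (Eq.sym 1+v≡q))) ⟨
      cast K (0 C suc v) + cast K (shifted 0 (suc v)) ∎
  ... | tri> _ _ q<1+v = begin
      cast K (q C suc v)                           ≡⟨ Eq.cong (cast K) (k>n⇒nCk≡0 q<1+v) ⟩
      0#                                           ≈⟨ +-identityˡ 0# ⟨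
      0# + 0#                                      ≡⟨ Eq.cong (λ k → 0# + cast K k)
                                                        (Eq.trans (shifted-≥ 0 (suc v) (ℕP.<⇒≤ q<1+v)) (k>n⇒nCk≡0 (ℕP.m<n⇒0<n∸m q<1+v))) ⟨
      cast K (0 C suc v) + cast K (shifted 0 (suc v)) ∎

  lucas : ∀ u v → cast K ((q ℕ.+ u) C v) ≈ cast K (u C v) + cast K (shifted u v)
  lucas zero v = trans (reflexive (Eq.cong (λ x → cast K (x C v)) (ℕP.+-identityʳ q))) (lucas-base v)
  lucas (suc u) zero = shifted-zero (suc u)
  lucas (suc u) (suc v) = begin
    cast K ((q ℕ.+ suc u) C suc v)
      ≡⟨ Eq.cong (λ x → cast K (x C suc v)) (ℕP.+-suc q u) ⟩
    cast K (suc (q ℕ.+ u) C suc v)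
      ≡⟨ Eq.cong (cast K) (nCk+nC[k+1]≡[n+1]C[k+1] (q ℕ.+ u) v) ⟨
    cast K ((q ℕ.+ u) C v ℕ.+ (q ℕ.+ u) C suc v)
      ≈⟨ cast-+ ((q ℕ.+ u) C v) ((q ℕ.+ u) C suc v) ⟩
    cast K ((q ℕ.+ u) C v) + cast K ((q ℕ.+ u) C suc v)
      ≈⟨ +-cong (lucas u v) (lucas u (suc v)) ⟩
    (cast K (u C v) + cast K (shifted u v)) + (cast K (u C suc v) + cast K (shifted u (suc v)))
      ≈⟨ +-interchange _ _ _ _ ⟩
    (cast K (u C v) + cast K (u C suc v)) + (cast K (shifted u v) + cast K (shifted u (suc v)))
      ≈⟨ +-cong (cast-+ (u C v) (u C suc v)) (cast-+ (shifted u v) (shifted u (suc v))) ⟨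
    cast K (u C v ℕ.+ u C suc v) + cast K (shifted u v ℕ.+ shifted u (suc v))
      ≡⟨ Eq.cong₂ (λ x y → cast K x + cast K y) (nCk+nC[k+1]≡[n+1]C[k+1] u v) (Eq.sym (shifted-pascal u v)) ⟩
    cast K (suc u C suc v) + cast K (shifted (suc u) (suc v)) ∎

  lucas-low : ∀ u v → v ℕ.< q → cast K ((q ℕ.+ u) C v) ≈ cast K (u C v)
  lucas-low u v v<q = trans (lucas u v) (trans (+-congˡ (reflexive (Eq.cong (cast K) (shifted-< u v v<q)))) (+-identityʳ _))

  lucas-high : ∀ u w → u ℕ.< q → cast K ((q ℕ.+ u) C (q ℕ.+ w)) ≈ cast K (u C w)
  lucas-high u w u<q = trans (lucas u (q ℕ.+ w))
    (trans (+-cong (reflexive (Eq.cong (cast K) (k>n⇒nCk≡0 (ℕP.≤-trans u<q (ℕP.m≤m+n q w)))))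
                   (reflexive (Eq.cong (cast K) (Eq.trans (shifted-≥ u (q ℕ.+ w) (ℕP.m≤m+n q w)) (Eq.cong (u C_) (ℕP.m+n∸m≡n q w))))))
       (+-identityˡ _))

module PrimeCharacteristic {c ℓ : Level} (K : CommutativeRing c ℓ) (p : ℕ) (pp : Prime p)
  (cast-p : CommutativeRing._≈_ K (cast K p) (CommutativeRing.0# K))
  (t : CommutativeRing.Carrier K) (t-transc : TranscendentalOverFp K p t) where
  open CommutativeRing K
  open import Relation.Binary.Reasoning.Setoid setoid
  open RingFacts K

  cast-multiple : ∀ {x} → p ∣ x → cast K x ≈ 0#
  cast-multiple {x} (divides k Eq.refl) = trans (cast-* k p) (trans (*-congˡ cast-p) (zeroʳ _))

  -- a natural number prime to p is nonzero in K (a nonzero constant polynomial in t)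
  cast-nonmultiple : ∀ {x} → ¬ (p ∣ x) → ¬ (cast K x ≈ 0#)
  cast-nonmultiple {x} p∤x x≈0 = t-transc (x ∷ []) (here p∤x) (trans (+-congˡ (zeroʳ t)) (trans (+-identityʳ _) x≈0))

  -- t is not a root of the polynomial X
  t≉0 : ¬ (t ≈ 0#)
  t≉0 t≈0 = t-transc (0 ∷ 1 ∷ []) (there (here (ArithmeticFacts.prime∤1 pp))) (begin
    0# + t * (cast K 1 + t * 0#) ≈⟨ +-identityˡ _ ⟩
    t * (cast K 1 + t * 0#)      ≈⟨ *-congʳ t≈0 ⟩
    0# * (cast K 1 + t * 0#)     ≈⟨ zeroˡ _ ⟩
    0#                           ∎)

  private
    eval-monomial : ∀ e B → evalPoly K (List.map (cast K) (replicate e 0 ++ B ∷ [])) t ≈ pow K t e * cast K B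
    eval-monomial zero B = trans (+-congˡ (zeroʳ t)) (trans (+-identityʳ _) (sym (*-identityˡ _)))
    eval-monomial (suc e) B = trans (+-identityˡ _) (trans (*-congˡ (eval-monomial e B)) (sym (*-assoc _ _ _)))

  binomial-nonzero : ∀ e A B → (¬ (p ∣ A) ⊎ ¬ (p ∣ B)) → ¬ (cast K A + pow K t (suc e) * cast K B ≈ 0#)
  binomial-nonzero e A B p∤A⊎p∤B A+tB≈0 = t-transc coeffs nonmultiple (begin
    cast K A + t * evalPoly K (List.map (cast K) (replicate e 0 ++ B ∷ [])) t
      ≈⟨ +-congˡ (*-congˡ (eval-monomial e B)) ⟩
    cast K A + t * (pow K t e * cast K B) ≈⟨ +-congˡ (sym (*-assoc _ _ _)) ⟩
    cast K A + pow K t (suc e) * cast K B ≈⟨ A+tB≈0 ⟩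
    0# ∎)
    where
    coeffs : List ℕ
    coeffs = A ∷ (replicate e 0 ++ B ∷ [])
    nonmultiple : Any (λ x → ¬ (p ∣ x)) coeffs
    nonmultiple = [ here , (λ p∤B → there (AnyP.++⁺ʳ (replicate e 0) (here p∤B))) ]′ p∤A⊎p∤B

-- After grouping indices by residue class, each block of the matrix is tiny:
-- class 0 has the three positions 0, 1, 2 and every other class the two positions 0, 1.
-- Pos c x says that x is a position of class c.
data Pos : ℕ → ℕ → Set where
  pos₀ : ∀ {c} → Pos c 0
  pos₁ : ∀ {c} → Pos c 1
  pos₂ : Pos 0 2

positions : ℕ → List ℕ
positions zero = 0 ∷ 1 ∷ 2 ∷ []
positions (suc _) = 0 ∷ 1 ∷ []

allPos₂ : ∀ {a} (R : ℕ → ℕ → Set a) → R 0 0 → R 0 1 → R 1 0 → R 1 1 →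
  ∀ {c} x y → Pos (suc c) x → Pos (suc c) y → R x y
allPos₂ R r₀₀ r₀₁ r₁₀ r₁₁ .0 .0 pos₀ pos₀ = r₀₀
allPos₂ R r₀₀ r₀₁ r₁₀ r₁₁ .0 .1 pos₀ pos₁ = r₀₁
allPos₂ R r₀₀ r₀₁ r₁₀ r₁₁ .1 .0 pos₁ pos₀ = r₁₀
allPos₂ R r₀₀ r₀₁ r₁₀ r₁₁ .1 .1 pos₁ pos₁ = r₁₁

allPos₃ : ∀ {a} (R : ℕ → ℕ → Set a) →
  R 0 0 → R 0 1 → R 0 2 → R 1 0 → R 1 1 → R 1 2 → R 2 0 → R 2 1 → R 2 2 →
  ∀ x y → Pos 0 x → Pos 0 y → R x y
allPos₃ R r₀₀ r₀₁ r₀₂ r₁₀ r₁₁ r₁₂ r₂₀ r₂₁ r₂₂ .0 .0 pos₀ pos₀ = r₀₀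
allPos₃ R r₀₀ r₀₁ r₀₂ r₁₀ r₁₁ r₁₂ r₂₀ r₂₁ r₂₂ .0 .1 pos₀ pos₁ = r₀₁
allPos₃ R r₀₀ r₀₁ r₀₂ r₁₀ r₁₁ r₁₂ r₂₀ r₂₁ r₂₂ .0 .2 pos₀ pos₂ = r₀₂
allPos₃ R r₀₀ r₀₁ r₀₂ r₁₀ r₁₁ r₁₂ r₂₀ r₂₁ r₂₂ .1 .0 pos₁ pos₀ = r₁₀
allPos₃ R r₀₀ r₀₁ r₀₂ r₁₀ r₁₁ r₁₂ r₂₀ r₂₁ r₂₂ .1 .1 pos₁ pos₁ = r₁₁
allPos₃ R r₀₀ r₀₁ r₀₂ r₁₀ r₁₁ r₁₂ r₂₀ r₂₁ r₂₂ .1 .2 pos₁ pos₂ = r₁₂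
allPos₃ R r₀₀ r₀₁ r₀₂ r₁₀ r₁₁ r₁₂ r₂₀ r₂₁ r₂₂ .2 .0 pos₂ pos₀ = r₂₀
allPos₃ R r₀₀ r₀₁ r₀₂ r₁₀ r₁₁ r₁₂ r₂₀ r₂₁ r₂₂ .2 .1 pos₂ pos₁ = r₂₁
allPos₃ R r₀₀ r₀₁ r₀₂ r₁₀ r₁₁ r₁₂ r₂₀ r₂₁ r₂₂ .2 .2 pos₂ pos₂ = r₂₂

module Blocks {a ℓ : Level} (K : CommutativeRing a ℓ) where
  open CommutativeRing K

  bsum : List ℕ → (ℕ → Carrier) → Carrier
  bsum [] f = 0#
  bsum (z ∷ zs) f = f z + bsum zs f

  bsum-zero : ∀ L (f : ℕ → Carrier) → (∀ z → f z ≈ 0#) → bsum L f ≈ 0#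
  bsum-zero [] f f≈0 = refl
  bsum-zero (z ∷ L) f f≈0 = trans (+-cong (f≈0 z) (bsum-zero L f f≈0)) (+-identityˡ 0#)

  bsum-cong : ∀ L {f g : ℕ → Carrier} → (∀ z → f z ≈ g z) → bsum L f ≈ bsum L g
  bsum-cong [] f≈g = refl
  bsum-cong (z ∷ L) f≈g = +-cong (f≈g z) (bsum-cong L f≈g)

  bsum-select : ∀ c x (W : ℕ → Carrier) → Pos c x → bsum (positions c) (λ z → if x ≡ᵇ z then W z else 0#) ≈ W x
  bsum-select zero .0 W pos₀ = trans (+-congˡ (trans (+-identityˡ _) (+-identityˡ _))) (+-identityʳ _)
  bsum-select (suc c) .0 W pos₀ = trans (+-congˡ (+-identityˡ _)) (+-identityʳ _)
  bsum-select zero .1 W pos₁ = trans (+-identityˡ _) (trans (+-congˡ (+-identityˡ _)) (+-identityʳ _))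
  bsum-select (suc c) .1 W pos₁ = trans (+-identityˡ _) (+-identityʳ _)
  bsum-select .0 .2 W pos₂ = trans (+-identityˡ _) (trans (+-identityˡ _) (+-identityʳ _))

  bprod : ℕ → (ℕ → ℕ → Carrier) → (ℕ → ℕ → Carrier) → ℕ → ℕ → Carrier
  bprod c F G x y = bsum (positions c) (λ z → F x z * G z y)

  idBlock : ℕ → ℕ → Carrier
  idBlock x y = if x ≡ᵇ y then 1# else 0#

  diagBlock : (ℕ → Carrier) → ℕ → ℕ → Carrier
  diagBlock d x y = if x ≡ᵇ y then d y else 0#

  record BlockDiagonalization (c : ℕ) (M : ℕ → ℕ → Carrier) : Set (a ⊔ ℓ) where
    field
      P Q : ℕ → ℕ → Carrier
      eigenvalue : ℕ → Carrier
      P·Q≈I : ∀ x y → Pos c x → Pos c y → bprod c P Q x y ≈ idBlock x y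
      Q·P≈I : ∀ x y → Pos c x → Pos c y → bprod c Q P x y ≈ idBlock x y
      M·P≈P·D : ∀ x y → Pos c x → Pos c y → bprod c M P x y ≈ bprod c P (diagBlock eigenvalue) x y

  blockDiagonalization-cong : ∀ {c M M′} → (∀ x y → Pos c x → Pos c y → M x y ≈ M′ x y) →
    BlockDiagonalization c M → BlockDiagonalization c M′
  blockDiagonalization-cong {zero} M≈M′ D = record
    { P = P ; Q = Q ; eigenvalue = eigenvalue ; P·Q≈I = P·Q≈I ; Q·P≈I = Q·P≈I
    ; M·P≈P·D = λ x y px py → trans
        (+-cong (*-congʳ (sym (M≈M′ x 0 px pos₀))) (+-cong (*-congʳ (sym (M≈M′ x 1 px pos₁)))
                (+-congʳ (*-congʳ (sym (M≈M′ x 2 px pos₂))))))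
        (M·P≈P·D x y px py) }
    where open BlockDiagonalization D
  blockDiagonalization-cong {suc c} M≈M′ D = record
    { P = P ; Q = Q ; eigenvalue = eigenvalue ; P·Q≈I = P·Q≈I ; Q·P≈I = Q·P≈I
    ; M·P≈P·D = λ x y px py → trans
        (+-cong (*-congʳ (sym (M≈M′ x 0 px pos₀))) (+-congʳ (*-congʳ (sym (M≈M′ x 1 px pos₁)))))
        (M·P≈P·D x y px py) }
    where open BlockDiagonalization D

module TwoByTwo {a ℓ : Level} (K : CommutativeRing a ℓ) (fld : IsField K) (acl : IsAlgClosed K) where
  open CommutativeRing K
  open import Relation.Binary.Reasoning.Setoid setoid
  open RingFacts K
  open FieldFacts K fld
  open Blocks K
  open Solver using (solve; _:=_; _:+_; _:*_; _:-_; :-_; con)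

  matrix₂ : Carrier → Carrier → Carrier → Carrier → ℕ → ℕ → Carrier
  matrix₂ α β γ δ zero zero = α
  matrix₂ α β γ δ zero (suc zero) = β
  matrix₂ α β γ δ (suc zero) zero = γ
  matrix₂ α β γ δ (suc zero) (suc zero) = δ
  matrix₂ α β γ δ _ _ = 0#

  vector₂ : Carrier → Carrier → ℕ → Carrier
  vector₂ μ₁ μ₂ zero = μ₁
  vector₂ μ₁ μ₂ (suc _) = μ₂

  matrix₂-entries : ∀ {k} (M : ℕ → ℕ → Carrier) x y → Pos (suc k) x → Pos (suc k) y →
    matrix₂ (M 0 0) (M 0 1) (M 1 0) (M 1 1) x y ≈ M x y
  matrix₂-entries M = allPos₂ _ refl refl refl refl

  discriminant : Carrier → Carrier → Carrier → Carrier → Carrier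
  discriminant α β γ δ = (α - δ) * (α - δ) + ofℕ 4 * (β * γ)

  discriminant-cong : ∀ {α β γ δ α′ β′ γ′ δ′} → α ≈ α′ → β ≈ β′ → γ ≈ γ′ → δ ≈ δ′ →
    discriminant α β γ δ ≈ discriminant α′ β′ γ′ δ′
  discriminant-cong {α} {δ = δ} {α′} {δ′ = δ′} α≈ β≈ γ≈ δ≈ = +-cong (*-cong α-δ≈ α-δ≈) (*-congˡ (*-cong β≈ γ≈))
    where
    α-δ≈ : α - δ ≈ α′ - δ′
    α-δ≈ = +-cong α≈ (-‿cong δ≈)

  charpoly : Carrier → Carrier → Carrier → Carrier → Carrier → Carrier
  charpoly α β γ δ x = x * x - (α + δ) * x + (α * δ - β * γ)

  private
    I O : ∀ {n} → Solver.Polynomial n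
    I = con (+ 1)
    O = con (+ 0)

    drop-zero : ∀ {x y z} → x ≈ y + - z → z ≈ 0# → x ≈ y
    drop-zero {x} {y} x≈y-z z≈0 = trans x≈y-z (trans (+-congˡ (trans (-‿cong z≈0) -0#≈0#)) (+-identityʳ y))

  diagonal-block : ∀ {k} α β γ δ → β ≈ 0# → γ ≈ 0# → BlockDiagonalization (suc k) (matrix₂ α β γ δ)
  diagonal-block α β γ δ β≈0 γ≈0 = record
    { P = matrix₂ 1# 0# 0# 1# ; Q = matrix₂ 1# 0# 0# 1# ; eigenvalue = vector₂ α δ
    ; P·Q≈I = identity² ; Q·P≈I = identity²
    ; M·P≈P·D = allPos₂ _
        (solve 2 (λ a b → a :* I :+ (b :* O :+ O) := I :* a :+ (O :* O :+ O)) refl α β)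
        (trans (+-congˡ (+-congʳ (*-congʳ β≈0))) (solve 2 (λ a d → a :* O :+ (O :* I :+ O) := I :* O :+ (O :* d :+ O)) refl α δ))
        (trans (+-congʳ (*-congʳ γ≈0)) (solve 2 (λ a d → O :* I :+ (d :* O :+ O) := O :* a :+ (I :* O :+ O)) refl α δ))
        (solve 2 (λ g d → g :* O :+ (d :* I :+ O) := O :* O :+ (I :* d :+ O)) refl γ δ) }
    where
    identity² : ∀ {k} x y → Pos (suc k) x → Pos (suc k) y → bprod (suc k) (matrix₂ 1# 0# 0# 1#) (matrix₂ 1# 0# 0# 1#) x y ≈ idBlock x y
    identity² = allPos₂ _
      (solve 0 (I :* I :+ (O :* O :+ O) := I) refl)
      (solve 0 (I :* O :+ (O :* I :+ O) := O) refl)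
      (solve 0 (O :* I :+ (I :* O :+ O) := O) refl)
      (solve 0 (O :* O :+ (I :* I :+ O) := I) refl)

  -- γ = 0, α ≠ δ: eigenvectors (1, 0) and (β, δ - α).
  triangular-block : ∀ {k} α β γ δ → γ ≈ 0# → ¬ (α - δ ≈ 0#) → BlockDiagonalization (suc k) (matrix₂ α β γ δ)
  triangular-block α β γ δ γ≈0 α-δ≉0 = record
    { P = matrix₂ 1# β 0# (δ - α) ; Q = matrix₂ 1# (- (β * e)) 0# e ; eigenvalue = vector₂ α δ
    ; P·Q≈I = allPos₂ _
        (solve 1 (λ b → I :* I :+ (b :* O :+ O) := I) refl β)
        (solve 2 (λ b e → I :* (:- (b :* e)) :+ (b :* e :+ O) := O) refl β e)
        (solve 2 (λ d e → O :* I :+ (d :* O :+ O) := O) refl (δ - α) e)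
        (trans (solve 3 (λ b d e → O :* (:- (b :* e)) :+ (d :* e :+ O) := d :* e) refl β (δ - α) e) de≈1)
    ; Q·P≈I = allPos₂ _
        (solve 2 (λ b e → I :* I :+ ((:- (b :* e)) :* O :+ O) := I) refl β e)
        (trans (solve 3 (λ b d e → I :* b :+ ((:- (b :* e)) :* d :+ O) := b :* (I :- d :* e)) refl β (δ - α) e)
           (trans (*-congˡ (+-congˡ (-‿cong de≈1))) (solve 1 (λ b → b :* (I :- I) := O) refl β)))
        (solve 1 (λ e → O :* I :+ (e :* O :+ O) := O) refl e)
        (trans (solve 3 (λ b d e → O :* b :+ (e :* d :+ O) := d :* e) refl β (δ - α) e) de≈1)
    ; M·P≈P·D = allPos₂ _
        (solve 2 (λ a b → a :* I :+ (b :* O :+ O) := I :* a :+ (b :* O :+ O)) refl α β)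
        (solve 3 (λ a b d → a :* b :+ (b :* (d :- a) :+ O) := I :* O :+ (b :* d :+ O)) refl α β δ)
        (trans (+-congʳ (*-congʳ γ≈0)) (solve 2 (λ a d → O :* I :+ (d :* O :+ O) := O :* a :+ ((d :- a) :* O :+ O)) refl α δ))
        (trans (+-congʳ (*-congʳ γ≈0)) (solve 3 (λ a b d → O :* b :+ (d :* (d :- a) :+ O) := O :* O :+ ((d :- a) :* d :+ O)) refl α β δ))
    }
    where
    δ-α≉0 : ¬ (δ - α ≈ 0#)
    δ-α≉0 δ-α≈0 = α-δ≉0 (trans (solve 2 (λ a d → a :- d := :- (d :- a)) refl α δ) (trans (-‿cong δ-α≈0) -0#≈0#))
    e : Carrier
    e = proj₁ (inverse (δ - α) δ-α≉0)
    de≈1 : (δ - α) * e ≈ 1#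
    de≈1 = proj₂ (inverse (δ - α) δ-α≉0)

  record DistinctEigenvalues (α β γ δ : Carrier) : Set (a ⊔ ℓ) where
    field
      μ₁ μ₂ : Carrier
      μ₁-root : charpoly α β γ δ μ₁ ≈ 0#
      μ₂-root : charpoly α β γ δ μ₂ ≈ 0#
      μ₁-μ₂≉0 : ¬ (μ₁ - μ₂ ≈ 0#)

  -- Over an algebraically closed field a nonzero discriminant gives two distinct eigenvalues:
  -- take a root μ₁, let μ₂ = (α + δ) - μ₁, and use (μ₁ - μ₂)² = disc + 4·charpoly(μ₁).
  distinct-eigenvalues : ∀ α β γ δ → ¬ (discriminant α β γ δ ≈ 0#) → DistinctEigenvalues α β γ δ
  distinct-eigenvalues α β γ δ disc≉0 = record
    { μ₁ = μ₁ ; μ₂ = μ₂ ; μ₁-root = μ₁-root ; μ₂-root = μ₂-root ; μ₁-μ₂≉0 = μ₁-μ₂≉0 }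
    where
    coefficient : Fin 2 → Carrier
    coefficient Fin.zero = α * δ - β * γ
    coefficient (Fin.suc _) = - (α + δ)
    root : ∃ λ x → pow K x 2 + sumFin K 2 (λ i → coefficient i * pow K x (toℕ i)) ≈ 0#
    root = acl 1 coefficient
    μ₁ μ₂ : Carrier
    μ₁ = proj₁ root
    μ₂ = (α + δ) - μ₁
    μ₁-root : charpoly α β γ δ μ₁ ≈ 0#
    μ₁-root = trans (solve 5 (λ x a b g d →
        x :* x :- (a :+ d) :* x :+ (a :* d :- b :* g) :=
        x :* (x :* I) :+ ((a :* d :- b :* g) :* I :+ ((:- (a :+ d)) :* (x :* I) :+ O))) refl μ₁ α β γ δ)
      (proj₂ root)
    μ₂-root : charpoly α β γ δ μ₂ ≈ 0#
    μ₂-root = trans (solve 5 (λ x a b g d →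
        ((a :+ d) :- x) :* ((a :+ d) :- x) :- (a :+ d) :* ((a :+ d) :- x) :+ (a :* d :- b :* g) :=
        x :* x :- (a :+ d) :* x :+ (a :* d :- b :* g)) refl μ₁ α β γ δ) μ₁-root
    gap² : (μ₁ - μ₂) * (μ₁ - μ₂) ≈ discriminant α β γ δ + ofℕ 4 * charpoly α β γ δ μ₁
    gap² = solve 5 (λ x a b g d →
        (x :- ((a :+ d) :- x)) :* (x :- ((a :+ d) :- x)) :=
        (a :- d) :* (a :- d) :+ con (+ 4) :* (b :* g) :+ con (+ 4) :* (x :* x :- (a :+ d) :* x :+ (a :* d :- b :* g)))
      refl μ₁ α β γ δ
    μ₁-μ₂≉0 : ¬ (μ₁ - μ₂ ≈ 0#)
    μ₁-μ₂≉0 gap≈0 = disc≉0 (begin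
      discriminant α β γ δ                                   ≈⟨ +-identityʳ _ ⟨
      discriminant α β γ δ + 0#                              ≈⟨ +-congˡ (trans (*-congˡ μ₁-root) (zeroʳ _)) ⟨
      discriminant α β γ δ + ofℕ 4 * charpoly α β γ δ μ₁     ≈⟨ gap² ⟨
      (μ₁ - μ₂) * (μ₁ - μ₂)                                  ≈⟨ *-congʳ gap≈0 ⟩
      0# * (μ₁ - μ₂)                                         ≈⟨ zeroˡ _ ⟩
      0#                                                     ∎)

  -- γ ≠ 0, nonzero discriminant: eigenvectors (μᵢ - δ, γ), whose determinant γ(μ₁ - μ₂) is invertible.
  generic-block : ∀ {k} α β γ δ → ¬ (γ ≈ 0#) → ¬ (discriminant α β γ δ ≈ 0#) →
    BlockDiagonalization (suc k) (matrix₂ α β γ δ)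
  generic-block α β γ δ γ≉0 disc≉0 = record
    { P = matrix₂ (μ₁ - δ) (μ₂ - δ) γ γ
    ; Q = matrix₂ (γ * e) (- ((μ₂ - δ) * e)) (- (γ * e)) ((μ₁ - δ) * e)
    ; eigenvalue = vector₂ μ₁ μ₂
    ; P·Q≈I = allPos₂ _
        (trans (solve 5 (λ x y d g e → (x :- d) :* (g :* e) :+ ((y :- d) :* (:- (g :* e)) :+ O) := (g :* (x :- y)) :* e) refl μ₁ μ₂ δ γ e) de≈1)
        (solve 5 (λ x y d g e → (x :- d) :* (:- ((y :- d) :* e)) :+ ((y :- d) :* ((x :- d) :* e) :+ O) := O) refl μ₁ μ₂ δ γ e)
        (solve 2 (λ g e → g :* (g :* e) :+ (g :* (:- (g :* e)) :+ O) := O) refl γ e)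
        (trans (solve 5 (λ x y d g e → g :* (:- ((y :- d) :* e)) :+ (g :* ((x :- d) :* e) :+ O) := (g :* (x :- y)) :* e) refl μ₁ μ₂ δ γ e) de≈1)
    ; Q·P≈I = allPos₂ _
        (trans (solve 5 (λ x y d g e → (g :* e) :* (x :- d) :+ ((:- ((y :- d) :* e)) :* g :+ O) := (g :* (x :- y)) :* e) refl μ₁ μ₂ δ γ e) de≈1)
        (solve 5 (λ x y d g e → (g :* e) :* (y :- d) :+ ((:- ((y :- d) :* e)) :* g :+ O) := O) refl μ₁ μ₂ δ γ e)
        (solve 5 (λ x y d g e → (:- (g :* e)) :* (x :- d) :+ (((x :- d) :* e) :* g :+ O) := O) refl μ₁ μ₂ δ γ e)
        (trans (solve 5 (λ x y d g e → (:- (g :* e)) :* (y :- d) :+ (((x :- d) :* e) :* g :+ O) := (g :* (x :- y)) :* e) refl μ₁ μ₂ δ γ e) de≈1)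
    ; M·P≈P·D = allPos₂ _
        (drop-zero (solve 6 (λ x y a b g d → a :* (x :- d) :+ (b :* g :+ O) :=
            (x :- d) :* x :+ ((y :- d) :* O :+ O) :+ :- (x :* x :- (a :+ d) :* x :+ (a :* d :- b :* g))) refl μ₁ μ₂ α β γ δ) μ₁-root)
        (drop-zero (solve 6 (λ x y a b g d → a :* (y :- d) :+ (b :* g :+ O) :=
            (x :- d) :* O :+ ((y :- d) :* y :+ O) :+ :- (y :* y :- (a :+ d) :* y :+ (a :* d :- b :* g))) refl μ₁ μ₂ α β γ δ) μ₂-root)
        (solve 4 (λ x y g d → g :* (x :- d) :+ (d :* g :+ O) := g :* x :+ (g :* O :+ O)) refl μ₁ μ₂ γ δ)
        (solve 4 (λ x y g d → g :* (y :- d) :+ (d :* g :+ O) := g :* O :+ (g :* y :+ O)) refl μ₁ μ₂ γ δ)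
    }
    where
    open DistinctEigenvalues (distinct-eigenvalues α β γ δ disc≉0)
    det≉0 : ¬ (γ * (μ₁ - μ₂) ≈ 0#)
    det≉0 = nonzero-* γ≉0 μ₁-μ₂≉0
    e : Carrier
    e = proj₁ (inverse (γ * (μ₁ - μ₂)) det≉0)
    de≈1 : (γ * (μ₁ - μ₂)) * e ≈ 1#
    de≈1 = proj₂ (inverse (γ * (μ₁ - μ₂)) det≉0)

-- The block of residue class 0 is, for any t and s, the 3×3 matrix
--        [ t   0     0    ]
--   V =  [ t   t·s  -t·s² ]
--        [ t   0     0    ]
-- with eigenvalues t, t·s, 0 and eigenvectors (1, 1+s, 1), (0, 1, 0), (0, s, 1).
-- Entries are kept as solver polynomials in t and s, so that each identity is one solver call.
module ThreeByThree {a ℓ : Level} (K : CommutativeRing a ℓ) (t s : CommutativeRing.Carrier K) where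
  open CommutativeRing K
  open RingFacts K
  open Blocks K
  open Solver using (solve; _:=_; _:+_; _:*_; :-_; con; var)

  private
    Poly : Set
    Poly = Solver.Polynomial 2

    I O : Poly
    I = con (+ 1)
    O = con (+ 0)

    Entries : Set
    Entries = ℕ → ℕ → Poly → Poly → Poly

    Pᵖ Qᵖ Vᵖ δᵖ : Entries
    Pᵖ 0 0 T S = I
    Pᵖ 1 0 T S = I :+ S
    Pᵖ 1 1 T S = I
    Pᵖ 1 2 T S = S
    Pᵖ 2 0 T S = I
    Pᵖ 2 2 T S = I
    Pᵖ _ _ T S = O
    Qᵖ 0 0 T S = I
    Qᵖ 1 0 T S = :- I
    Qᵖ 1 1 T S = I
    Qᵖ 1 2 T S = :- S
    Qᵖ 2 0 T S = :- I
    Qᵖ 2 2 T S = I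
    Qᵖ _ _ T S = O
    Vᵖ 0 0 T S = T
    Vᵖ 1 0 T S = T
    Vᵖ 1 1 T S = T :* S
    Vᵖ 1 2 T S = :- (T :* (S :* S))
    Vᵖ 2 0 T S = T
    Vᵖ _ _ T S = O
    δᵖ 0 0 T S = I
    δᵖ 1 1 T S = I
    δᵖ 2 2 T S = I
    δᵖ _ _ T S = O

    eigenvalueᵖ : ℕ → Poly → Poly → Poly
    eigenvalueᵖ 0 T S = T
    eigenvalueᵖ 1 T S = T :* S
    eigenvalueᵖ _ T S = O

    _·ᵖ_ : Entries → Entries → Entries
    (F ·ᵖ G) x y T S = F x 0 T S :* G 0 y T S :+ (F x 1 T S :* G 1 y T S :+ (F x 2 T S :* G 2 y T S :+ O))

    Dᵖ : Entries
    Dᵖ x y T S = if x ≡ᵇ y then eigenvalueᵖ y T S else O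

    ⟦_⟧ : Entries → ℕ → ℕ → Carrier
    ⟦ F ⟧ x y = Solver.⟦ F x y (var Fin.zero) (var (Fin.suc Fin.zero)) ⟧ (t Vec.∷ s Vec.∷ Vec.[])

  V₃ : ℕ → ℕ → Carrier
  V₃ = ⟦ Vᵖ ⟧

  V₃-diagonalization : BlockDiagonalization 0 V₃
  V₃-diagonalization = record
    { P = ⟦ Pᵖ ⟧ ; Q = ⟦ Qᵖ ⟧ ; eigenvalue = λ y → Solver.⟦ eigenvalueᵖ y (var Fin.zero) (var (Fin.suc Fin.zero)) ⟧ (t Vec.∷ s Vec.∷ Vec.[])
    ; P·Q≈I = allPos₃ _
        (solve 2 (λ T S → (Pᵖ ·ᵖ Qᵖ) 0 0 T S := δᵖ 0 0 T S) refl t s)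
        (solve 2 (λ T S → (Pᵖ ·ᵖ Qᵖ) 0 1 T S := δᵖ 0 1 T S) refl t s)
        (solve 2 (λ T S → (Pᵖ ·ᵖ Qᵖ) 0 2 T S := δᵖ 0 2 T S) refl t s)
        (solve 2 (λ T S → (Pᵖ ·ᵖ Qᵖ) 1 0 T S := δᵖ 1 0 T S) refl t s)
        (solve 2 (λ T S → (Pᵖ ·ᵖ Qᵖ) 1 1 T S := δᵖ 1 1 T S) refl t s)
        (solve 2 (λ T S → (Pᵖ ·ᵖ Qᵖ) 1 2 T S := δᵖ 1 2 T S) refl t s)
        (solve 2 (λ T S → (Pᵖ ·ᵖ Qᵖ) 2 0 T S := δᵖ 2 0 T S) refl t s)
        (solve 2 (λ T S → (Pᵖ ·ᵖ Qᵖ) 2 1 T S := δᵖ 2 1 T S) refl t s)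
        (solve 2 (λ T S → (Pᵖ ·ᵖ Qᵖ) 2 2 T S := δᵖ 2 2 T S) refl t s)
    ; Q·P≈I = allPos₃ _
        (solve 2 (λ T S → (Qᵖ ·ᵖ Pᵖ) 0 0 T S := δᵖ 0 0 T S) refl t s)
        (solve 2 (λ T S → (Qᵖ ·ᵖ Pᵖ) 0 1 T S := δᵖ 0 1 T S) refl t s)
        (solve 2 (λ T S → (Qᵖ ·ᵖ Pᵖ) 0 2 T S := δᵖ 0 2 T S) refl t s)
        (solve 2 (λ T S → (Qᵖ ·ᵖ Pᵖ) 1 0 T S := δᵖ 1 0 T S) refl t s)
        (solve 2 (λ T S → (Qᵖ ·ᵖ Pᵖ) 1 1 T S := δᵖ 1 1 T S) refl t s)
        (solve 2 (λ T S → (Qᵖ ·ᵖ Pᵖ) 1 2 T S := δᵖ 1 2 T S) refl t s)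
        (solve 2 (λ T S → (Qᵖ ·ᵖ Pᵖ) 2 0 T S := δᵖ 2 0 T S) refl t s)
        (solve 2 (λ T S → (Qᵖ ·ᵖ Pᵖ) 2 1 T S := δᵖ 2 1 T S) refl t s)
        (solve 2 (λ T S → (Qᵖ ·ᵖ Pᵖ) 2 2 T S := δᵖ 2 2 T S) refl t s)
    ; M·P≈P·D = allPos₃ _
        (solve 2 (λ T S → (Vᵖ ·ᵖ Pᵖ) 0 0 T S := (Pᵖ ·ᵖ Dᵖ) 0 0 T S) refl t s)
        (solve 2 (λ T S → (Vᵖ ·ᵖ Pᵖ) 0 1 T S := (Pᵖ ·ᵖ Dᵖ) 0 1 T S) refl t s)
        (solve 2 (λ T S → (Vᵖ ·ᵖ Pᵖ) 0 2 T S := (Pᵖ ·ᵖ Dᵖ) 0 2 T S) refl t s)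
        (solve 2 (λ T S → (Vᵖ ·ᵖ Pᵖ) 1 0 T S := (Pᵖ ·ᵖ Dᵖ) 1 0 T S) refl t s)
        (solve 2 (λ T S → (Vᵖ ·ᵖ Pᵖ) 1 1 T S := (Pᵖ ·ᵖ Dᵖ) 1 1 T S) refl t s)
        (solve 2 (λ T S → (Vᵖ ·ᵖ Pᵖ) 1 2 T S := (Pᵖ ·ᵖ Dᵖ) 1 2 T S) refl t s)
        (solve 2 (λ T S → (Vᵖ ·ᵖ Pᵖ) 2 0 T S := (Pᵖ ·ᵖ Dᵖ) 2 0 T S) refl t s)
        (solve 2 (λ T S → (Vᵖ ·ᵖ Pᵖ) 2 1 T S := (Pᵖ ·ᵖ Dᵖ) 2 1 T S) refl t s)
        (solve 2 (λ T S → (Vᵖ ·ᵖ Pᵖ) 2 2 T S := (Pᵖ ·ᵖ Dᵖ) 2 2 T S) refl t s)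
    }

module ResidueIndices (m : ℕ) {{_ : NonZero m}} (n : ℕ) (n≡2m+1 : n ≡ suc (m ℕ.+ m)) where
  residue position : ℕ → ℕ
  residue i = i % m
  position i = i / m

  index≡ : ∀ i → i ≡ residue i ℕ.+ position i ℕ.* m
  index≡ i = m≡m%n+[m/n]*n i m

  residue<m : ∀ i → residue i ℕ.< m
  residue<m i = m%n<n i m

  residue-index : ∀ c x → c ℕ.< m → residue (c ℕ.+ x ℕ.* m) ≡ c
  residue-index c x c<m = Eq.trans ([m+kn]%n≡m%n c x m) (m<n⇒m%n≡m c<m)

  index-injective : ∀ c x y → c ℕ.+ x ℕ.* m ≡ c ℕ.+ y ℕ.* m → x ≡ y
  index-injective c x y e = ℕP.*-cancelʳ-≡ x y m (ℕP.+-cancelˡ-≡ c _ _ e)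

  index-≡ᵇ : ∀ c x y → ((c ℕ.+ x ℕ.* m) ≡ᵇ (c ℕ.+ y ℕ.* m)) ≡ (x ≡ᵇ y)
  index-≡ᵇ c x y with x ℕ.≟ y
  ... | yes Eq.refl = Eq.trans (≡ᵇ-refl (c ℕ.+ x ℕ.* m)) (Eq.sym (≡ᵇ-refl x))
  ... | no x≢y = Eq.trans (≢⇒≡ᵇ-false (λ e → x≢y (index-injective c x y e))) (Eq.sym (≢⇒≡ᵇ-false x≢y))

  residue-position-injective : ∀ i j → residue i ≡ residue j → position i ≡ position j → i ≡ j
  residue-position-injective i j e₁ e₂ =
    Eq.trans (index≡ i) (Eq.trans (Eq.cong₂ (λ c x → c ℕ.+ x ℕ.* m) e₁ e₂) (Eq.sym (index≡ j)))

  m∣distance⇒same-residue-≤ : ∀ i j → i ℕ.≤ j → m ∣ (i ℕ.∸ j) ℕ.+ (j ℕ.∸ i) → residue i ≡ residue j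
  m∣distance⇒same-residue-≤ i j i≤j (divides x d≡xm) = Eq.sym (Eq.trans (Eq.cong residue j≡i+xm) ([m+kn]%n≡m%n i x m))
    where
    j≡i+xm : j ≡ i ℕ.+ x ℕ.* m
    j≡i+xm = Eq.trans (Eq.sym (ℕP.m+[n∸m]≡n i≤j))
               (Eq.cong (i ℕ.+_) (Eq.trans (Eq.sym (Eq.cong (ℕ._+ (j ℕ.∸ i)) (ℕP.m≤n⇒m∸n≡0 i≤j))) d≡xm))

  m∣distance⇒same-residue : ∀ i j → m ∣ (i ℕ.∸ j) ℕ.+ (j ℕ.∸ i) → residue i ≡ residue j
  m∣distance⇒same-residue i j m∣d with ℕP.≤-total i j
  ... | inj₁ i≤j = m∣distance⇒same-residue-≤ i j i≤j m∣d
  ... | inj₂ j≤i = Eq.sym (m∣distance⇒same-residue-≤ j i j≤i (Eq.subst (m ∣_) (ℕP.+-comm (i ℕ.∸ j) (j ℕ.∸ i)) m∣d))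

  index<n⇒Pos : ∀ c x → c ℕ.+ x ℕ.* m ℕ.< n → Pos c x
  index<n⇒Pos c zero _ = pos₀
  index<n⇒Pos c (suc zero) _ = pos₁
  index<n⇒Pos zero (suc (suc zero)) _ = pos₂
  index<n⇒Pos (suc c) (suc (suc zero)) c+2m<n = contradiction c+2m<n (ℕP.≤⇒≯ (begin
    n                               ≡⟨ n≡2m+1 ⟩
    suc (m ℕ.+ m)                   ≡⟨ Eq.cong (λ x → suc (m ℕ.+ x)) (ℕP.+-identityʳ m) ⟨
    suc (m ℕ.+ (m ℕ.+ 0))           ≤⟨ s≤s (ℕP.m≤n+m _ c) ⟩
    suc c ℕ.+ (m ℕ.+ (m ℕ.+ 0))     ∎))
    where open ℕP.≤-Reasoning 
  index<n⇒Pos c (suc (suc (suc x))) c+3m<n = contradiction c+3m<n (ℕP.≤⇒≯ (begin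
    n                                               ≡⟨ n≡2m+1 ⟩
    1 ℕ.+ (m ℕ.+ m)                                 ≤⟨ ℕP.+-monoˡ-≤ (m ℕ.+ m) (ℕ.>-nonZero⁻¹ m) ⟩
    m ℕ.+ (m ℕ.+ m)                                 ≤⟨ ℕP.+-monoʳ-≤ m (ℕP.+-monoʳ-≤ m (ℕP.m≤m+n m _)) ⟩
    m ℕ.+ (m ℕ.+ (m ℕ.+ x ℕ.* m))                   ≤⟨ ℕP.m≤n+m _ c ⟩
    c ℕ.+ (m ℕ.+ (m ℕ.+ (m ℕ.+ x ℕ.* m)))           ∎))
    where open ℕP.≤-Reasoning 

  positions<n : ∀ c → c ℕ.< m → All (λ x → c ℕ.+ x ℕ.* m ℕ.< n) (positions c)
  positions<n zero c<m rewrite n≡2m+1 =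
    s≤s z≤n ∷ s≤s (ℕP.≤-trans (ℕP.≤-reflexive (ℕP.+-identityʳ m)) (ℕP.m≤m+n m m)) ∷
    s≤s (ℕP.≤-reflexive (Eq.cong (m ℕ.+_) (ℕP.+-identityʳ m))) ∷ []
  positions<n (suc c) c<m rewrite n≡2m+1 =
    Eq.subst (ℕ._< suc (m ℕ.+ m)) (Eq.sym (ℕP.+-identityʳ (suc c))) (ℕP.≤-trans c<m (ℕP.≤-trans (ℕP.m≤m+n m m) (ℕP.n≤1+n _))) ∷
    s≤s (ℕP.≤-trans (ℕP.≤-reflexive (Eq.cong (λ x → suc (c ℕ.+ x)) (ℕP.+-identityʳ m))) (ℕP.+-monoˡ-≤ m (ℕP.<⇒≤ c<m))) ∷ []


-- An index i < n = 2m+1 is written i = residue i + position i · m;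
-- the residue class 0 contains the indices 0, m, 2m and every other class c < m the indices c, c + m.
-- A matrix whose entries vanish between different classes is assembled from its class blocks by
-- fromBlocks, which turns matrix products into blockwise products; hence such a matrix is
-- diagonalizable as soon as each of its blocks is.
module ResidueBlocks {a ℓ : Level} (K : CommutativeRing a ℓ) (m : ℕ) {{_ : NonZero m}}
  (n : ℕ) (n≡2m+1 : n ≡ suc (m ℕ.+ m)) where
  open CommutativeRing K
  open import Relation.Binary.Reasoning.Setoid setoid
  open RingFacts K
  open Blocks K
  open ResidueIndices m n n≡2m+1

  sumℕ : ℕ → (ℕ → Carrier) → Carrier
  sumℕ zero f = 0#
  sumℕ (suc k) f = f 0 + sumℕ k (λ l → f (suc l))

  sumFin≡sumℕ : ∀ k (f : ℕ → Carrier) → sumFin K k (λ l → f (toℕ l)) ≡ sumℕ k f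
  sumFin≡sumℕ zero f = Eq.refl
  sumFin≡sumℕ (suc k) f = Eq.cong (λ s → f 0 + s) (sumFin≡sumℕ k (λ l → f (suc l)))

  sumℕ-cong : ∀ k {f g : ℕ → Carrier} → (∀ l → l ℕ.< k → f l ≈ g l) → sumℕ k f ≈ sumℕ k g
  sumℕ-cong zero f≈g = refl
  sumℕ-cong (suc k) f≈g = +-cong (f≈g 0 (s≤s z≤n)) (sumℕ-cong k (λ l l<k → f≈g (suc l) (s≤s l<k)))

  sumℕ-zero : ∀ k {f : ℕ → Carrier} → (∀ l → l ℕ.< k → f l ≈ 0#) → sumℕ k f ≈ 0#
  sumℕ-zero zero f≈0 = refl
  sumℕ-zero (suc k) f≈0 = trans (+-cong (f≈0 0 (s≤s z≤n)) (sumℕ-zero k (λ l l<k → f≈0 (suc l) (s≤s l<k)))) (+-identityˡ 0#)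

  sumℕ-+ : ∀ k (f g : ℕ → Carrier) → sumℕ k (λ l → f l + g l) ≈ sumℕ k f + sumℕ k g
  sumℕ-+ zero f g = sym (+-identityˡ 0#)
  sumℕ-+ (suc k) f g = trans (+-congˡ (sumℕ-+ k _ _)) (+-interchange _ _ _ _)

  sumℕ-indicator : ∀ k s (w : Carrier) → s ℕ.< k → sumℕ k (λ l → if l ≡ᵇ s then w else 0#) ≈ w
  sumℕ-indicator (suc k) zero w _ = trans (+-congˡ (sumℕ-zero k (λ _ _ → refl))) (+-identityʳ w)
  sumℕ-indicator (suc k) (suc s) w (s≤s s<k) = trans (+-identityˡ _) (sumℕ-indicator k s w s<k)

  fromBlocks : (ℕ → ℕ → ℕ → Carrier) → ℕ → ℕ → Carrier
  fromBlocks F i j = if residue i ≡ᵇ residue j then F (residue i) (position i) (position j) else 0#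

  fromBlocks-same : ∀ F i j → residue i ≡ residue j → fromBlocks F i j ≡ F (residue i) (position i) (position j)
  fromBlocks-same F i j e = Eq.cong (λ b → if b then F (residue i) (position i) (position j) else 0#) (≡⇒≡ᵇ-true e)

  fromBlocks-different : ∀ F i j → (residue i ≡ᵇ residue j) ≡ false → fromBlocks F i j ≡ 0#
  fromBlocks-different F i j e = Eq.cong (λ b → if b then F (residue i) (position i) (position j) else 0#) e

  blockProduct : (ℕ → ℕ → ℕ → Carrier) → (ℕ → ℕ → ℕ → Carrier) → ℕ → ℕ → ℕ → Carrier
  blockProduct F G c = bprod c (F c) (G c)

  product-term : ∀ F G i j l → residue i ≡ residue j → l ℕ.< n →
    fromBlocks F i l * fromBlocks G l j ≈
    bsum (positions (residue i)) (λ x → if l ≡ᵇ (residue i ℕ.+ x ℕ.* m) then F (residue i) (position i) x * G (residue i) x (position j) else 0#)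
  product-term F G i j l i~j l<n = boolCase (residue i ≡ᵇ residue l) same-class other-class
    where
    c : ℕ
    c = residue i
    W : ℕ → Carrier
    W x = F c (position i) x * G c x (position j)
    selected : Carrier
    selected = bsum (positions c) (λ x → if l ≡ᵇ (c ℕ.+ x ℕ.* m) then W x else 0#)
    other-class : (c ≡ᵇ residue l) ≡ false → fromBlocks F i l * fromBlocks G l j ≈ selected
    other-class i≁l = trans (trans (*-congʳ (reflexive (fromBlocks-different F i l i≁l))) (zeroˡ _))
                           (sym (bsum-zero (positions c) _ vanish))
      where
      vanish : ∀ x → (if l ≡ᵇ (c ℕ.+ x ℕ.* m) then W x else 0#) ≈ 0#
      vanish x with l ≡ᵇ (c ℕ.+ x ℕ.* m) in e
      ... | false = refl
      ... | true = contradiction (Eq.sym (Eq.trans (Eq.cong residue (≡ᵇ-true⇒≡ e)) (residue-index c x (residue<m i))))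
                                 (≡ᵇ-false⇒≢ i≁l)
    same-class : (c ≡ᵇ residue l) ≡ true → fromBlocks F i l * fromBlocks G l j ≈ selected
    same-class i~l = begin
      fromBlocks F i l * fromBlocks G l j
        ≈⟨ *-cong (reflexive (fromBlocks-same F i l c≡l)) (reflexive (fromBlocks-same G l j (Eq.trans (Eq.sym c≡l) i~j))) ⟩
      F c (position i) (position l) * G (residue l) (position l) (position j)
        ≡⟨ Eq.cong (λ c′ → F c (position i) (position l) * G c′ (position l) (position j)) (Eq.sym c≡l) ⟩
      W (position l)
        ≈⟨ bsum-select c (position l) W (index<n⇒Pos c (position l) (Eq.subst (ℕ._< n) l≡ l<n)) ⟨
      bsum (positions c) (λ x → if position l ≡ᵇ x then W x else 0#)
        ≈⟨ bsum-cong (positions c) (λ x → reflexive (Eq.cong (λ b → if b then W x else 0#)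
             (Eq.trans (Eq.sym (index-≡ᵇ c (position l) x)) (Eq.cong (_≡ᵇ (c ℕ.+ x ℕ.* m)) (Eq.sym l≡))))) ⟩
      bsum (positions c) (λ x → if l ≡ᵇ (c ℕ.+ x ℕ.* m) then W x else 0#) ∎
      where
      c≡l : c ≡ residue l
      c≡l = ≡ᵇ-true⇒≡ i~l
      l≡ : l ≡ c ℕ.+ position l ℕ.* m
      l≡ = Eq.trans (index≡ l) (Eq.cong (λ x → x ℕ.+ position l ℕ.* m) (Eq.sym c≡l))

  sum-indicators : ∀ c (W : ℕ → Carrier) L → All (λ x → c ℕ.+ x ℕ.* m ℕ.< n) L →
    sumℕ n (λ l → bsum L (λ x → if l ≡ᵇ (c ℕ.+ x ℕ.* m) then W x else 0#)) ≈ bsum L W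
  sum-indicators c W [] [] = sumℕ-zero n (λ _ _ → refl)
  sum-indicators c W (x ∷ L) (x<n ∷ L<n) =
    trans (sumℕ-+ n (λ l → if l ≡ᵇ (c ℕ.+ x ℕ.* m) then W x else 0#) _)
          (+-cong (sumℕ-indicator n _ (W x) x<n) (sum-indicators c W L L<n))

  fromBlocks-product : ∀ F G i j → sumℕ n (λ l → fromBlocks F i l * fromBlocks G l j) ≈ fromBlocks (blockProduct F G) i j
  fromBlocks-product F G i j = boolCase (residue i ≡ᵇ residue j) same-class other-class
    where
    other-class : (residue i ≡ᵇ residue j) ≡ false → sumℕ n (λ l → fromBlocks F i l * fromBlocks G l j) ≈ fromBlocks (blockProduct F G) i j
    other-class i≁j = trans (sumℕ-zero n vanish) (sym (reflexive (fromBlocks-different (blockProduct F G) i j i≁j)))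
      where
      vanish : ∀ l → l ℕ.< n → fromBlocks F i l * fromBlocks G l j ≈ 0#
      vanish l _ = boolCase (residue i ≡ᵇ residue l)
        (λ i~l → trans (*-congˡ (reflexive (fromBlocks-different G l j
                    (Eq.subst (λ c → (c ≡ᵇ residue j) ≡ false) (≡ᵇ-true⇒≡ {residue i} {residue l} i~l) i≁j)))) (zeroʳ _))
        (λ i≁l → trans (*-congʳ (reflexive (fromBlocks-different F i l i≁l))) (zeroˡ _))
    same-class : (residue i ≡ᵇ residue j) ≡ true → sumℕ n (λ l → fromBlocks F i l * fromBlocks G l j) ≈ fromBlocks (blockProduct F G) i j
    same-class i~j = begin
      sumℕ n (λ l → fromBlocks F i l * fromBlocks G l j)
        ≈⟨ sumℕ-cong n (λ l l<n → product-term F G i j l c≡ l<n) ⟩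
      sumℕ n (λ l → bsum (positions c) (λ x → if l ≡ᵇ (c ℕ.+ x ℕ.* m) then F c (position i) x * G c x (position j) else 0#))
        ≈⟨ sum-indicators c (λ x → F c (position i) x * G c x (position j)) (positions c) (positions<n c (residue<m i)) ⟩
      blockProduct F G c (position i) (position j)
        ≡⟨ fromBlocks-same (blockProduct F G) i j c≡ ⟨
      fromBlocks (blockProduct F G) i j ∎
      where
      c : ℕ
      c = residue i
      c≡ : residue i ≡ residue j
      c≡ = ≡ᵇ-true⇒≡ i~j

  fromBlocks-cong : ∀ F G → (∀ c x y → c ℕ.< m → c ℕ.+ x ℕ.* m ℕ.< n → c ℕ.+ y ℕ.* m ℕ.< n → F c x y ≈ G c x y) →
    ∀ i j → i ℕ.< n → j ℕ.< n → fromBlocks F i j ≈ fromBlocks G i j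
  fromBlocks-cong F G F≈G i j i<n j<n = boolCase (residue i ≡ᵇ residue j)
    (λ i~j → let e = ≡ᵇ-true⇒≡ i~j in begin
      fromBlocks F i j                          ≡⟨ fromBlocks-same F i j e ⟩
      F (residue i) (position i) (position j)   ≈⟨ F≈G (residue i) (position i) (position j) (residue<m i)
                                                     (Eq.subst (ℕ._< n) (index≡ i) i<n)
                                                     (Eq.subst (ℕ._< n) (Eq.trans (index≡ j) (Eq.cong (λ x → x ℕ.+ position j ℕ.* m) (Eq.sym e))) j<n) ⟩
      G (residue i) (position i) (position j)   ≡⟨ fromBlocks-same G i j e ⟨
      fromBlocks G i j                          ∎)
    (λ i≁j → trans (reflexive (fromBlocks-different F i j i≁j)) (sym (reflexive (fromBlocks-different G i j i≁j))))

  diagonal-fromBlocks : ∀ (d : ℕ → ℕ → Carrier) i j →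
    (if i ≡ᵇ j then d (residue j) (position j) else 0#) ≈ fromBlocks (λ c → diagBlock (d c)) i j
  diagonal-fromBlocks d i j = boolCase (i ≡ᵇ j)
    (λ i≡ᵇj → trans (reflexive (Eq.cong (λ b → if b then d (residue j) (position j) else 0#) i≡ᵇj))
       (Eq.subst (λ j → d (residue j) (position j) ≈ fromBlocks D i j) (≡ᵇ-true⇒≡ i≡ᵇj) on-diagonal))
    (λ i≢ᵇj → trans (reflexive (Eq.cong (λ b → if b then d (residue j) (position j) else 0#) i≢ᵇj))
       (boolCase (residue i ≡ᵇ residue j)
          (λ i~j → sym (trans (reflexive (fromBlocks-same D i j (≡ᵇ-true⇒≡ i~j)))
                  (reflexive (Eq.cong (λ b → if b then d (residue i) (position j) else 0#)
                     (≢⇒≡ᵇ-false (λ e → ≡ᵇ-false⇒≢ i≢ᵇj (residue-position-injective i j (≡ᵇ-true⇒≡ i~j) e)))))))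
          (λ i≁j → sym (reflexive (fromBlocks-different D i j i≁j)))))
    where
    D : ℕ → ℕ → ℕ → Carrier
    D c = diagBlock (d c)
    on-diagonal : d (residue i) (position i) ≈ fromBlocks D i i
    on-diagonal = sym (trans (reflexive (fromBlocks-same D i i Eq.refl))
                         (reflexive (Eq.cong (λ b → if b then d (residue i) (position i) else 0#) (≡ᵇ-refl (position i)))))

  block : (ℕ → ℕ → Carrier) → ℕ → ℕ → ℕ → Carrier
  block M c x y = M (c ℕ.+ x ℕ.* m) (c ℕ.+ y ℕ.* m)

  fromBlocks-block : ∀ (M : ℕ → ℕ → Carrier) → (∀ i j → residue i ≢ residue j → M i j ≈ 0#) →
    ∀ i j → M i j ≈ fromBlocks (block M) i j
  fromBlocks-block M vanish i j = boolCase (residue i ≡ᵇ residue j)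
    (λ i~j → trans (reflexive (Eq.cong₂ M (index≡ i)
                      (Eq.trans (index≡ j) (Eq.cong (λ x → x ℕ.+ position j ℕ.* m) (Eq.sym (≡ᵇ-true⇒≡ i~j))))))
                   (sym (reflexive (fromBlocks-same (block M) i j (≡ᵇ-true⇒≡ i~j)))))
    (λ i≁j → trans (vanish i j (≡ᵇ-false⇒≢ i≁j)) (sym (reflexive (fromBlocks-different (block M) i j i≁j))))

  module _ (M : ℕ → ℕ → Carrier) (vanish : ∀ i j → residue i ≢ residue j → M i j ≈ 0#)
           (blocks : ∀ c → c ℕ.< m → BlockDiagonalization c (block M c)) where
    private
      -- the block data of each class; classes c ≥ m do not occur and get zero blocks
      P-block Q-block : ℕ → ℕ → ℕ → Carrier
      P-block c with c ℕ.<? m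
      ... | yes c<m = BlockDiagonalization.P (blocks c c<m)
      ... | no _ = λ _ _ → 0#
      Q-block c with c ℕ.<? m
      ... | yes c<m = BlockDiagonalization.Q (blocks c c<m)
      ... | no _ = λ _ _ → 0#

      eigenvalue-block : ℕ → ℕ → Carrier
      eigenvalue-block c with c ℕ.<? m
      ... | yes c<m = BlockDiagonalization.eigenvalue (blocks c c<m)
      ... | no _ = λ _ → 0#

      Bounded : (ℕ → ℕ → ℕ → Carrier) → (ℕ → ℕ → ℕ → Carrier) → Set ℓ
      Bounded F G = ∀ c x y → c ℕ.< m → c ℕ.+ x ℕ.* m ℕ.< n → c ℕ.+ y ℕ.* m ℕ.< n → F c x y ≈ G c x y

      P·Q≈I : Bounded (blockProduct P-block Q-block) (λ _ → idBlock)
      P·Q≈I c x y c<m x<n y<n with c ℕ.<? m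
      ... | yes c<m′ = BlockDiagonalization.P·Q≈I (blocks c c<m′) x y (index<n⇒Pos c x x<n) (index<n⇒Pos c y y<n)
      ... | no c≮m = contradiction c<m c≮m

      Q·P≈I : Bounded (blockProduct Q-block P-block) (λ _ → idBlock)
      Q·P≈I c x y c<m x<n y<n with c ℕ.<? m
      ... | yes c<m′ = BlockDiagonalization.Q·P≈I (blocks c c<m′) x y (index<n⇒Pos c x x<n) (index<n⇒Pos c y y<n)
      ... | no c≮m = contradiction c<m c≮m

      M·P≈P·D : Bounded (blockProduct (block M) P-block) (blockProduct P-block (λ c → diagBlock (eigenvalue-block c)))
      M·P≈P·D c x y c<m x<n y<n with c ℕ.<? m
      ... | yes c<m′ = BlockDiagonalization.M·P≈P·D (blocks c c<m′) x y (index<n⇒Pos c x x<n) (index<n⇒Pos c y y<n)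
      ... | no c≮m = contradiction c<m c≮m

      toMat : (ℕ → ℕ → Carrier) → Mat K n
      toMat F i j = F (toℕ i) (toℕ j)

      product-toMat : ∀ F G (i j : Fin n) →
        _⊗_ K (toMat (fromBlocks F)) (toMat (fromBlocks G)) i j ≈ fromBlocks (blockProduct F G) (toℕ i) (toℕ j)
      product-toMat F G i j = trans (reflexive (sumFin≡sumℕ n _)) (fromBlocks-product F G (toℕ i) (toℕ j))

      identity-toMat : ∀ (i j : Fin n) → fromBlocks (λ _ → idBlock) (toℕ i) (toℕ j) ≈ idMat K i j
      identity-toMat i j = sym (diagonal-fromBlocks (λ _ _ → 1#) (toℕ i) (toℕ j))

      inverse-blocks : ∀ F G → Bounded (blockProduct F G) (λ _ → idBlock) →
        _≈M_ K (_⊗_ K (toMat (fromBlocks F)) (toMat (fromBlocks G))) (idMat K)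
      inverse-blocks F G F·G≈I i j = trans (product-toMat F G i j)
        (trans (fromBlocks-cong _ _ F·G≈I (toℕ i) (toℕ j) (toℕ<n i) (toℕ<n j)) (identity-toMat i j))

    blockwise-diagonalizable : Diagonalizable K (toMat M)
    blockwise-diagonalizable = P , Q , eigenvalue , inverse-blocks P-block Q-block P·Q≈I , inverse-blocks Q-block P-block Q·P≈I , M·P≈P·Dₘ
      where
      P Q : Mat K n
      P = toMat (fromBlocks P-block)
      Q = toMat (fromBlocks Q-block)
      eigenvalue : Fin n → Carrier
      eigenvalue j = eigenvalue-block (residue (toℕ j)) (position (toℕ j))
      D : ℕ → ℕ → ℕ → Carrier
      D c = diagBlock (eigenvalue-block c)
      M·P≈P·Dₘ : _≈M_ K (_⊗_ K (toMat M) P) (_⊗_ K P (diagMat K eigenvalue))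
      M·P≈P·Dₘ i j = begin
        _⊗_ K (toMat M) P i j
          ≡⟨ sumFin≡sumℕ n (λ l → M i′ l * fromBlocks P-block l j′) ⟩
        sumℕ n (λ l → M i′ l * fromBlocks P-block l j′)
          ≈⟨ sumℕ-cong n (λ l _ → *-congʳ (fromBlocks-block M vanish i′ l)) ⟩
        sumℕ n (λ l → fromBlocks (block M) i′ l * fromBlocks P-block l j′)
          ≈⟨ fromBlocks-product (block M) P-block i′ j′ ⟩
        fromBlocks (blockProduct (block M) P-block) i′ j′
          ≈⟨ fromBlocks-cong _ _ M·P≈P·D i′ j′ (toℕ<n i) (toℕ<n j) ⟩
        fromBlocks (blockProduct P-block D) i′ j′
          ≈⟨ fromBlocks-product P-block D i′ j′ ⟨
        sumℕ n (λ l → fromBlocks P-block i′ l * fromBlocks D l j′)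
          ≈⟨ sumℕ-cong n (λ l _ → *-congˡ (diagonal-fromBlocks eigenvalue-block l j′)) ⟨
        sumℕ n (λ l → fromBlocks P-block i′ l * (if l ≡ᵇ j′ then eigenvalue-block (residue j′) (position j′) else 0#))
          ≡⟨ sumFin≡sumℕ n (λ l → fromBlocks P-block i′ l * (if l ≡ᵇ j′ then eigenvalue-block (residue j′) (position j′) else 0#)) ⟨
        _⊗_ K P (diagMat K eigenvalue) i j ∎
        where
        i′ j′ : ℕ
        i′ = toℕ i
        j′ = toℕ j

module UtEntries {a ℓ : Level} (K : CommutativeRing a ℓ) (q k : ℕ) (t : CommutativeRing.Carrier K) where
  open CommutativeRing K

  diagonalEntry : ℕ → ℕ → Carrier
  diagonalEntry κ j = - (pow K (- t) (suc j) * cast K ((κ ℕ.∸ j) C j))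

  offDiagonalEntry : ℕ → ℕ → ℕ → Carrier
  offDiagonalEntry κ i j =
    - (pow K t (suc j) * (cast K (binomZ K (κ ℕ.∸ i) i j) + pow K (- 1#) (suc j) * cast K ((κ ℕ.∸ i) C j)))

  private
    offPart : ℕ → ℕ → Carrier
    offPart i j = if does ((q ℕ.∸ 1) ∣? absDiff K i j) then offDiagonalEntry (k ℕ.∸ 2) i j else 0#

    off-diagonal : ∀ i j → i ≢ j → UtEntry K q k t i j ≡ offPart i j
    off-diagonal i j i≢j = Eq.cong (λ b → if b then diagonalEntry (k ℕ.∸ 2) j else offPart i j) (≢⇒≡ᵇ-false i≢j)

  entry-diagonal : ∀ j → UtEntry K q k t j j ≡ diagonalEntry (k ℕ.∸ 2) j
  entry-diagonal j = Eq.cong (λ b → if b then diagonalEntry (k ℕ.∸ 2) j else offPart j j) (≡ᵇ-refl j)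

  entry-related : ∀ i j → i ≢ j → (q ℕ.∸ 1) ∣ absDiff K i j → UtEntry K q k t i j ≡ offDiagonalEntry (k ℕ.∸ 2) i j
  entry-related i j i≢j d = Eq.trans (off-diagonal i j i≢j)
    (Eq.cong (λ b → if b then offDiagonalEntry (k ℕ.∸ 2) i j else 0#) (dec-true ((q ℕ.∸ 1) ∣? absDiff K i j) d))

  entry-unrelated : ∀ i j → i ≢ j → ¬ ((q ℕ.∸ 1) ∣ absDiff K i j) → UtEntry K q k t i j ≡ 0#
  entry-unrelated i j i≢j ∤ = Eq.trans (off-diagonal i j i≢j)
    (Eq.cong (λ b → if b then offDiagonalEntry (k ℕ.∸ 2) i j else 0#) (dec-false ((q ℕ.∸ 1) ∣? absDiff K i j) ∤))

  binomZ-< : ∀ x i j → j ℕ.< i → binomZ K x i j ≡ 0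
  binomZ-< x i j j<i = Eq.cong (λ b → if b then x C (j ℕ.∸ i) else 0) (>⇒≤ᵇ-false j<i)

  binomZ-≤ : ∀ x i j → i ℕ.≤ j → binomZ K x i j ≡ x C (j ℕ.∸ i)
  binomZ-≤ x i j i≤j = Eq.cong (λ b → if b then x C (j ℕ.∸ i) else 0) (≤⇒≤ᵇ-true i≤j)

-- Class 0 gives the 3×3 block of ThreeByThree with s = t^m. A class a with 1 ≤ a < m, m = a + 1 + u,
-- gives by the Lucas congruence the 2×2 block
--   [ -(-t)^(a+1) C(u,a)   -(-1)^(a+1) t^(a+1) s C(u,a-1) ]
--   [ -(-1)^(a+1) t^(a+1) C(u+1,a)          0            ]
-- which is diagonalizable by TwoByTwo: the binomial coefficients decide which case applies, and the
-- transcendence of t makes the discriminant nonzero when needed.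
module AtkinMatrix {c ℓ : Level} (K : CommutativeRing c ℓ) (fld : IsField K) (acl : IsAlgClosed K)
  (p : ℕ) (pp : Prime p) (p≢2 : p ≢ 2)
  (cast-p : CommutativeRing._≈_ K (cast K p) (CommutativeRing.0# K))
  (t : CommutativeRing.Carrier K) (t-transc : TranscendentalOverFp K p t)
  (m : ℕ) {{_ : NonZero m}} (h : ℕ) (m≡h+h : m ≡ h ℕ.+ h)
  (p∣binom-q : ∀ v → 0 ℕ.< v → v ℕ.< suc m → p ∣ suc m C v) where
  open CommutativeRing K
  open import Relation.Binary.Reasoning.Setoid setoid
  open RingFacts K
  open FieldFacts K fld
  open PrimeCharacteristic K p pp cast-p t t-transc
  open Blocks K
  open TwoByTwo K fld acl
  open ArithmeticFacts using (prime∤-*; odd-prime∤4)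
  open Solver using (solve; _:=_; _:+_; _:*_; _:-_; :-_; con)

  q n : ℕ
  q = suc m
  n = 2 ℕ.* q ℕ.∸ 1

  n≡2m+1 : n ≡ suc (m ℕ.+ m)
  n≡2m+1 = Eq.trans (Eq.cong (λ x → (q ℕ.+ x) ℕ.∸ 1) (ℕP.+-identityʳ q)) (ℕP.+-suc m m)

  k-2≡2m : 2 ℕ.* q ℕ.∸ 2 ≡ m ℕ.+ m
  k-2≡2m = Eq.trans (Eq.cong (λ x → (q ℕ.+ x) ℕ.∸ 2) (ℕP.+-identityʳ q)) (Eq.cong (ℕ._∸ 1) (ℕP.+-suc m m))

  open UtEntries K q (2 ℕ.* q) t
  open ResidueIndices m n n≡2m+1
  open ResidueBlocks K m n n≡2m+1
  open Lucas K q (s≤s z≤n) (λ v 0<v v<q → cast-multiple (p∣binom-q v 0<v v<q))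

  E : ℕ → ℕ → Carrier
  E = UtEntry K q (2 ℕ.* q) t

  s : Carrier
  s = pow K t m

  0<m : 0 ℕ.< m
  0<m = ℕ.>-nonZero⁻¹ m

  m<2m : m ℕ.< m ℕ.+ m
  m<2m = Eq.subst (ℕ._< m ℕ.+ m) (ℕP.+-identityʳ m) (ℕP.+-monoʳ-< m 0<m)

  pow-minusOne-m : pow K (- 1#) m ≈ 1#
  pow-minusOne-m = trans (reflexive (Eq.cong (pow K (- 1#)) m≡h+h)) (pow-minusOne-even h)

  E-diagonal : ∀ j → E j j ≡ diagonalEntry (m ℕ.+ m) j
  E-diagonal j = Eq.trans (entry-diagonal j) (Eq.cong (λ κ → diagonalEntry κ j) k-2≡2m)

  E-related : ∀ i j → i ≢ j → m ∣ absDiff K i j → E i j ≡ offDiagonalEntry (m ℕ.+ m) i j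
  E-related i j i≢j m∣d = Eq.trans (entry-related i j i≢j m∣d) (Eq.cong (λ κ → offDiagonalEntry κ i j) k-2≡2m)

  E-above : ∀ i j x → j ≡ i ℕ.+ suc x ℕ.* m → E i j ≡ offDiagonalEntry (m ℕ.+ m) i j
  E-above i j x Eq.refl = E-related i j i≢j (divides (suc x) distance)
    where
    i<j : i ℕ.< i ℕ.+ suc x ℕ.* m
    i<j = Eq.subst (ℕ._< i ℕ.+ suc x ℕ.* m) (ℕP.+-identityʳ i) (ℕP.+-monoʳ-< i (ℕP.<-≤-trans 0<m (ℕP.m≤m+n m _)))
    i≢j : i ≢ i ℕ.+ suc x ℕ.* m
    i≢j e = ℕP.<-irrefl e i<j
    distance : absDiff K i (i ℕ.+ suc x ℕ.* m) ≡ suc x ℕ.* m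
    distance = Eq.cong₂ ℕ._+_ (ℕP.m≤n⇒m∸n≡0 (ℕP.<⇒≤ i<j)) (ℕP.m+n∸m≡n i (suc x ℕ.* m))

  E-below : ∀ i j x → i ≡ j ℕ.+ suc x ℕ.* m → E i j ≡ offDiagonalEntry (m ℕ.+ m) i j
  E-below i j x Eq.refl = E-related i j (λ e → ℕP.<-irrefl (Eq.sym e) j<i) (divides (suc x) distance)
    where
    j<i : j ℕ.< j ℕ.+ suc x ℕ.* m
    j<i = Eq.subst (ℕ._< j ℕ.+ suc x ℕ.* m) (ℕP.+-identityʳ j) (ℕP.+-monoʳ-< j (ℕP.<-≤-trans 0<m (ℕP.m≤m+n m _)))
    distance : absDiff K (j ℕ.+ suc x ℕ.* m) j ≡ suc x ℕ.* m
    distance = Eq.trans (ℕP.+-comm ((j ℕ.+ suc x ℕ.* m) ℕ.∸ j) (j ℕ.∸ (j ℕ.+ suc x ℕ.* m))) (Eq.cong₂ ℕ._+_ (ℕP.m≤n⇒m∸n≡0 (ℕP.<⇒≤ j<i)) (ℕP.m+n∸m≡n j (suc x ℕ.* m)))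

  E-across-classes : ∀ i j → residue i ≢ residue j → E i j ≈ 0#
  E-across-classes i j i≁j = reflexive (entry-unrelated i j (λ i≡j → i≁j (Eq.cong residue i≡j))
    (λ m∣d → i≁j (m∣distance⇒same-residue i j m∣d)))

  1m≡m : 1 ℕ.* m ≡ m
  1m≡m = ℕP.+-identityʳ m

  2m≡2m : 2 ℕ.* m ≡ m ℕ.+ m
  2m≡2m = Eq.cong (m ℕ.+_) (ℕP.+-identityʳ m)

  private
    I O : ∀ {k} → Solver.Polynomial k
    I = con (+ 1)
    O = con (+ 0)

  E₀₀ : E 0 0 ≈ t
  E₀₀ = solve 1 (λ x → :- ((:- x :* I) :* (I :+ O)) := x) refl t

  E₁₀ : E m 0 ≈ t
  E₁₀ = begin
    E m 0 ≡⟨ E-below m 0 0 (Eq.sym 1m≡m) ⟩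
    - (pow K t 1 * (cast K (binomZ K ((m ℕ.+ m) ℕ.∸ m) m 0) + pow K (- 1#) 1 * cast K 1))
      ≡⟨ Eq.cong (λ z → - (pow K t 1 * (cast K z + pow K (- 1#) 1 * cast K 1))) (binomZ-< _ m 0 0<m) ⟩
    - ((t * 1#) * (0# + (- 1# * 1#) * (1# + 0#))) ≈⟨ solve 1 (λ x → :- ((x :* I) :* (O :+ (:- I :* I) :* (I :+ O))) := x) refl t ⟩
    t ∎

  E₂₀ : E (m ℕ.+ m) 0 ≈ t
  E₂₀ = begin
    E (m ℕ.+ m) 0 ≡⟨ E-below (m ℕ.+ m) 0 1 (Eq.sym 2m≡2m) ⟩
    - (pow K t 1 * (cast K (binomZ K ((m ℕ.+ m) ℕ.∸ (m ℕ.+ m)) (m ℕ.+ m) 0) + pow K (- 1#) 1 * cast K 1))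
      ≡⟨ Eq.cong (λ z → - (pow K t 1 * (cast K z + pow K (- 1#) 1 * cast K 1))) (binomZ-< _ (m ℕ.+ m) 0 (ℕP.<-trans 0<m m<2m)) ⟩
    - ((t * 1#) * (0# + (- 1# * 1#) * (1# + 0#))) ≈⟨ solve 1 (λ x → :- ((x :* I) :* (O :+ (:- I :* I) :* (I :+ O))) := x) refl t ⟩
    t ∎

  E₀₁ : E 0 m ≈ 0#
  E₀₁ = begin
    E 0 m ≡⟨ E-above 0 m 0 (Eq.sym 1m≡m) ⟩
    - (pow K t (suc m) * (cast K B + pow K (- 1#) (suc m) * cast K B)) ≈⟨ -‿cong (*-congˡ (+-congˡ (*-congʳ (*-congˡ pow-minusOne-m)))) ⟩
    - (pow K t (suc m) * (cast K B + (- 1# * 1#) * cast K B)) ≈⟨ solve 2 (λ x b → :- (x :* (b :+ (:- I :* I) :* b)) := O) refl (pow K t (suc m)) (cast K B) ⟩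
    0# ∎
    where
    B : ℕ
    B = (m ℕ.+ m) C m

  E₁₁ : E m m ≈ t * s
  E₁₁ = begin
    E m m ≡⟨ E-diagonal m ⟩
    - (pow K (- t) (suc m) * cast K (((m ℕ.+ m) ℕ.∸ m) C m)) ≡⟨ Eq.cong (λ z → - (pow K (- t) (suc m) * cast K (z C m))) (ℕP.m+n∸m≡n m m) ⟩
    - (pow K (- t) (suc m) * cast K (m C m))                 ≡⟨ Eq.cong (λ z → - (pow K (- t) (suc m) * cast K z)) (nCn≡1 m) ⟩
    - (pow K (- t) (suc m) * cast K 1)                       ≈⟨ -‿cong (*-congʳ (trans (pow-neg t (suc m)) (*-congʳ (*-congˡ pow-minusOne-m)))) ⟩
    - (((- 1# * 1#) * (t * s)) * (1# + 0#))                  ≈⟨ solve 2 (λ x y → :- (((:- I :* I) :* (x :* y)) :* (I :+ O)) := x :* y) refl t s ⟩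
    t * s ∎

  E₂₁ : E (m ℕ.+ m) m ≈ 0#
  E₂₁ = begin
    E (m ℕ.+ m) m ≡⟨ E-below (m ℕ.+ m) m 0 (Eq.sym 2m≡2m) ⟩
    - (pow K t (suc m) * (cast K (binomZ K ((m ℕ.+ m) ℕ.∸ (m ℕ.+ m)) (m ℕ.+ m) m) + pow K (- 1#) (suc m) * cast K (((m ℕ.+ m) ℕ.∸ (m ℕ.+ m)) C m)))
      ≡⟨ Eq.cong₂ (λ z w → - (pow K t (suc m) * (cast K z + pow K (- 1#) (suc m) * cast K w)))
           (binomZ-< _ (m ℕ.+ m) m m<2m)
           (Eq.trans (Eq.cong (_C m) (ℕP.n∸n≡0 (m ℕ.+ m))) (k>n⇒nCk≡0 0<m)) ⟩
    - (pow K t (suc m) * (0# + pow K (- 1#) (suc m) * 0#)) ≈⟨ solve 2 (λ x w → :- (x :* (O :+ w :* O)) := O) refl (pow K t (suc m)) (pow K (- 1#) (suc m)) ⟩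
    0# ∎

  E₀₂ : E 0 (m ℕ.+ m) ≈ 0#
  E₀₂ = begin
    E 0 (m ℕ.+ m) ≡⟨ E-above 0 (m ℕ.+ m) 1 (Eq.sym 2m≡2m) ⟩
    - (pow K t (suc (m ℕ.+ m)) * (cast K ((m ℕ.+ m) C (m ℕ.+ m)) + pow K (- 1#) (suc (m ℕ.+ m)) * cast K ((m ℕ.+ m) C (m ℕ.+ m))))
      ≡⟨ Eq.cong (λ z → - (pow K t (suc (m ℕ.+ m)) * (cast K z + pow K (- 1#) (suc (m ℕ.+ m)) * cast K z))) (nCn≡1 (m ℕ.+ m)) ⟩
    - (pow K t (suc (m ℕ.+ m)) * (cast K 1 + pow K (- 1#) (suc (m ℕ.+ m)) * cast K 1))
      ≈⟨ -‿cong (*-congˡ (+-congˡ (*-congʳ (*-congˡ (pow-minusOne-even m))))) ⟩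
    - (pow K t (suc (m ℕ.+ m)) * ((1# + 0#) + (- 1# * 1#) * (1# + 0#)))
      ≈⟨ solve 1 (λ x → :- (x :* ((I :+ O) :+ (:- I :* I) :* (I :+ O))) := O) refl (pow K t (suc (m ℕ.+ m))) ⟩
    0# ∎

  E₁₂ : E m (m ℕ.+ m) ≈ - (t * (s * s))
  E₁₂ = begin
    E m (m ℕ.+ m) ≡⟨ E-above m (m ℕ.+ m) 0 (Eq.sym 2m≡2m) ⟩
    - (pow K t (suc (m ℕ.+ m)) * (cast K (binomZ K ((m ℕ.+ m) ℕ.∸ m) m (m ℕ.+ m)) + pow K (- 1#) (suc (m ℕ.+ m)) * cast K (((m ℕ.+ m) ℕ.∸ m) C (m ℕ.+ m))))
      ≡⟨ Eq.cong₂ (λ z w → - (pow K t (suc (m ℕ.+ m)) * (cast K z + pow K (- 1#) (suc (m ℕ.+ m)) * cast K w)))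
           (Eq.trans (binomZ-≤ _ m (m ℕ.+ m) (ℕP.<⇒≤ m<2m)) (Eq.trans (Eq.cong₂ _C_ 2m∸m≡m 2m∸m≡m) (nCn≡1 m)))
           (Eq.trans (Eq.cong (_C (m ℕ.+ m)) 2m∸m≡m) (k>n⇒nCk≡0 m<2m)) ⟩
    - (pow K t (suc (m ℕ.+ m)) * ((1# + 0#) + pow K (- 1#) (suc (m ℕ.+ m)) * 0#)) ≈⟨ -‿cong (*-congʳ (*-congˡ (pow-+ t m m))) ⟩
    - ((t * (s * s)) * ((1# + 0#) + pow K (- 1#) (suc (m ℕ.+ m)) * 0#))
      ≈⟨ solve 3 (λ x y w → :- ((x :* (y :* y)) :* ((I :+ O) :+ w :* O)) := :- (x :* (y :* y))) refl t s (pow K (- 1#) (suc (m ℕ.+ m))) ⟩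
    - (t * (s * s)) ∎
    where
    2m∸m≡m : (m ℕ.+ m) ℕ.∸ m ≡ m
    2m∸m≡m = ℕP.m+n∸m≡n m m

  E₂₂ : E (m ℕ.+ m) (m ℕ.+ m) ≈ 0#
  E₂₂ = begin
    E (m ℕ.+ m) (m ℕ.+ m) ≡⟨ E-diagonal (m ℕ.+ m) ⟩
    - (pow K (- t) (suc (m ℕ.+ m)) * cast K (((m ℕ.+ m) ℕ.∸ (m ℕ.+ m)) C (m ℕ.+ m)))
      ≡⟨ Eq.cong (λ z → - (pow K (- t) (suc (m ℕ.+ m)) * cast K z)) (Eq.trans (Eq.cong (_C (m ℕ.+ m)) (ℕP.n∸n≡0 (m ℕ.+ m))) (k>n⇒nCk≡0 (ℕP.<-trans 0<m m<2m))) ⟩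
    - (pow K (- t) (suc (m ℕ.+ m)) * 0#) ≈⟨ solve 1 (λ x → :- (x :* O) := O) refl (pow K (- t) (suc (m ℕ.+ m))) ⟩
    0# ∎

  class₀-block : BlockDiagonalization 0 (block E 0)
  class₀-block = blockDiagonalization-cong V≈block V₃-diagonalization
    where
    open ThreeByThree K t s
    V≈block : ∀ x y → Pos 0 x → Pos 0 y → V₃ x y ≈ block E 0 x y
    V≈block = allPos₃ _
      (sym E₀₀)
      (sym (trans (reflexive (Eq.cong (E 0) 1m≡m)) E₀₁))
      (sym (trans (reflexive (Eq.cong (E 0) 2m≡2m)) E₀₂))
      (sym (trans (reflexive (Eq.cong (λ i → E i 0) 1m≡m)) E₁₀))
      (sym (trans (reflexive (Eq.cong₂ E 1m≡m 1m≡m)) E₁₁))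
      (sym (trans (reflexive (Eq.cong₂ E 1m≡m 2m≡2m)) E₁₂))
      (sym (trans (reflexive (Eq.cong (λ i → E i 0) 2m≡2m)) E₂₀))
      (sym (trans (reflexive (Eq.cong₂ E 2m≡2m 1m≡m)) E₂₁))
      (sym (trans (reflexive (Eq.cong₂ E 2m≡2m 2m≡2m)) E₂₂))

  module ClassBlock (b u : ℕ) (m≡a+1+u : m ≡ suc (suc b ℕ.+ u)) where
    a : ℕ
    a = suc b

    T σ : Carrier
    T = pow K t (suc a)
    σ = pow K (- 1#) (suc a)

    D X Y : ℕ
    D = u C a
    X = u C b
    Y = suc u C a

    pascal : X ℕ.+ D ≡ Y
    pascal = nCk+nC[k+1]≡[n+1]C[k+1] u b

    private
      m≡a+u+1 : m ≡ a ℕ.+ suc u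
      m≡a+u+1 = Eq.trans m≡a+1+u (Eq.sym (ℕP.+-suc a u))
      a≤m : a ℕ.≤ m
      a≤m = Eq.subst (a ℕ.≤_) (Eq.sym m≡a+u+1) (ℕP.m≤m+n a (suc u))
      u<m : u ℕ.< m
      u<m = Eq.subst (suc u ℕ.≤_) (Eq.sym m≡a+u+1) (ℕP.m≤n+m (suc u) a)
      a<a+m : a ℕ.< a ℕ.+ m
      a<a+m = Eq.subst (ℕ._< a ℕ.+ m) (ℕP.+-identityʳ a) (ℕP.+-monoʳ-< a 0<m)
      m∸a : m ℕ.∸ a ≡ suc u
      m∸a = Eq.trans (Eq.cong (ℕ._∸ a) m≡a+u+1) (ℕP.m+n∸m≡n a (suc u))
      2m∸a : (m ℕ.+ m) ℕ.∸ a ≡ q ℕ.+ u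
      2m∸a = Eq.trans (ℕP.+-∸-assoc m a≤m) (Eq.trans (Eq.cong (m ℕ.+_) m∸a) (ℕP.+-suc m u))
      2m∸[a+m] : (m ℕ.+ m) ℕ.∸ (a ℕ.+ m) ≡ suc u
      2m∸[a+m] = Eq.trans (Eq.cong ((m ℕ.+ m) ℕ.∸_) (ℕP.+-comm a m)) (Eq.trans (ℕP.[m+n]∸[m+o]≡n∸o m m a) m∸a)
      a+m≡q+b : a ℕ.+ m ≡ q ℕ.+ b
      a+m≡q+b = Eq.cong suc (ℕP.+-comm b m)
      a+m≡a+1m : a ℕ.+ m ≡ a ℕ.+ 1 ℕ.* m
      a+m≡a+1m = Eq.cong (a ℕ.+_) (Eq.sym 1m≡m)
      index₀ : a ℕ.+ 0 ℕ.* m ≡ a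
      index₀ = ℕP.+-identityʳ a
      index₁ : a ℕ.+ 1 ℕ.* m ≡ a ℕ.+ m
      index₁ = Eq.sym a+m≡a+1m

    α≈ : block E a 0 0 ≈ - ((σ * T) * cast K D)
    α≈ = begin
      block E a 0 0                                              ≡⟨ Eq.cong₂ E index₀ index₀ ⟩
      E a a                                                      ≡⟨ E-diagonal a ⟩
      - (pow K (- t) (suc a) * cast K (((m ℕ.+ m) ℕ.∸ a) C a))   ≡⟨ Eq.cong (λ z → - (pow K (- t) (suc a) * cast K (z C a))) 2m∸a ⟩
      - (pow K (- t) (suc a) * cast K ((q ℕ.+ u) C a))           ≈⟨ -‿cong (*-cong (pow-neg t (suc a)) (lucas-low u a (s≤s a≤m))) ⟩
      - ((σ * T) * cast K D)                                     ∎

    β≈ : block E a 0 1 ≈ - ((T * s) * (σ * cast K X))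
    β≈ = begin
      block E a 0 1 ≡⟨ Eq.cong₂ E index₀ index₁ ⟩
      E a (a ℕ.+ m) ≡⟨ E-above a (a ℕ.+ m) 0 a+m≡a+1m ⟩
      - (pow K t (suc (a ℕ.+ m)) * (cast K (binomZ K ((m ℕ.+ m) ℕ.∸ a) a (a ℕ.+ m)) + pow K (- 1#) (suc (a ℕ.+ m)) * cast K (((m ℕ.+ m) ℕ.∸ a) C (a ℕ.+ m))))
        ≡⟨ Eq.cong₂ (λ z w → - (pow K t (suc (a ℕ.+ m)) * (cast K z + pow K (- 1#) (suc (a ℕ.+ m)) * cast K w)))
             (Eq.trans (binomZ-≤ _ a (a ℕ.+ m) (ℕP.<⇒≤ a<a+m)) (Eq.cong₂ _C_ 2m∸a (ℕP.m+n∸m≡n a m)))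
             (Eq.cong₂ _C_ 2m∸a a+m≡q+b) ⟩
      - (pow K t (suc (a ℕ.+ m)) * (cast K ((q ℕ.+ u) C m) + pow K (- 1#) (suc (a ℕ.+ m)) * cast K ((q ℕ.+ u) C (q ℕ.+ b))))
        ≈⟨ -‿cong (*-cong (pow-+ t (suc a) m)
              (+-cong (trans (lucas-low u m ℕP.≤-refl) (reflexive (Eq.cong (cast K) (k>n⇒nCk≡0 u<m))))
                      (*-cong (trans (pow-+ (- 1#) (suc a) m) (*-congˡ pow-minusOne-m))
                              (lucas-high u b (ℕP.<-trans u<m ℕP.≤-refl))))) ⟩
      - ((T * s) * (0# + (σ * 1#) * cast K X))
        ≈⟨ solve 4 (λ x y g b → :- ((x :* y) :* (O :+ (g :* I) :* b)) := :- ((x :* y) :* (g :* b))) refl T s σ (cast K X) ⟩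
      - ((T * s) * (σ * cast K X)) ∎

    γ≈ : block E a 1 0 ≈ - (T * (σ * cast K Y))
    γ≈ = begin
      block E a 1 0 ≡⟨ Eq.cong₂ E index₁ index₀ ⟩
      E (a ℕ.+ m) a ≡⟨ E-below (a ℕ.+ m) a 0 a+m≡a+1m ⟩
      - (T * (cast K (binomZ K ((m ℕ.+ m) ℕ.∸ (a ℕ.+ m)) (a ℕ.+ m) a) + σ * cast K (((m ℕ.+ m) ℕ.∸ (a ℕ.+ m)) C a)))
        ≡⟨ Eq.cong₂ (λ z w → - (T * (cast K z + σ * cast K w))) (binomZ-< _ (a ℕ.+ m) a a<a+m) (Eq.cong (_C a) 2m∸[a+m]) ⟩
      - (T * (0# + σ * cast K Y)) ≈⟨ -‿cong (*-congˡ (+-identityˡ _)) ⟩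
      - (T * (σ * cast K Y)) ∎

    δ≈ : block E a 1 1 ≈ 0#
    δ≈ = begin
      block E a 1 1 ≡⟨ Eq.cong₂ E index₁ index₁ ⟩
      E (a ℕ.+ m) (a ℕ.+ m) ≡⟨ E-diagonal (a ℕ.+ m) ⟩
      - (pow K (- t) (suc (a ℕ.+ m)) * cast K (((m ℕ.+ m) ℕ.∸ (a ℕ.+ m)) C (a ℕ.+ m)))
        ≡⟨ Eq.cong (λ z → - (pow K (- t) (suc (a ℕ.+ m)) * cast K z))
             (Eq.trans (Eq.cong (_C (a ℕ.+ m)) 2m∸[a+m]) (k>n⇒nCk≡0 {suc u} {a ℕ.+ m} (ℕP.≤-<-trans u<m (ℕP.m<n+m m (s≤s z≤n))))) ⟩
      - (pow K (- t) (suc (a ℕ.+ m)) * 0#) ≈⟨ solve 1 (λ x → :- (x :* O) := O) refl (pow K (- t) (suc (a ℕ.+ m))) ⟩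
      0# ∎

    α β γ δ : Carrier
    α = block E a 0 0
    β = block E a 0 1
    γ = block E a 1 0
    δ = block E a 1 1

    private
      T≉0 : ¬ (T ≈ 0#)
      T≉0 = nonzero-pow (suc a) t≉0
      σ≉0 : ¬ (σ ≈ 0#)
      σ≉0 = nonzero-pow (suc a) (nonzero-neg 1≉0)

    -- disc = σ² T² (D² + 4 s X Y), which is nonzero as soon as p ∤ D² or p ∤ 4XY, since t is transcendental.
    discriminant≈ : discriminant α β γ δ ≈ (σ * σ) * ((T * T) * (cast K (D ℕ.* D) + s * cast K (4 ℕ.* (X ℕ.* Y))))
    discriminant≈ = begin
      discriminant α β γ δ
        ≈⟨ discriminant-cong α≈ β≈ γ≈ δ≈ ⟩
      discriminant (- ((σ * T) * cast K D)) (- ((T * s) * (σ * cast K X))) (- (T * (σ * cast K Y))) 0#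
        ≈⟨ solve 6 (λ g x y d b e →
             (:- ((g :* x) :* d) :- O) :* (:- ((g :* x) :* d) :- O) :+ con (+ 4) :* ((:- ((x :* y) :* (g :* b))) :* (:- (x :* (g :* e))))
             := (g :* g) :* ((x :* x) :* (d :* d :+ y :* (con (+ 4) :* (b :* e))))) refl σ T s (cast K D) (cast K X) (cast K Y) ⟩
      (σ * σ) * ((T * T) * (cast K D * cast K D + s * (ofℕ 4 * (cast K X * cast K Y))))
        ≈⟨ *-congˡ (*-congˡ (+-cong (sym (cast-* D D))
             (*-congˡ (sym (trans (cast-* 4 (X ℕ.* Y)) (*-cong (sym (ofℕ≈cast 4)) (cast-* X Y))))))) ⟩
      (σ * σ) * ((T * T) * (cast K (D ℕ.* D) + s * cast K (4 ℕ.* (X ℕ.* Y)))) ∎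

    discriminant≉0 : ¬ (p ∣ D ℕ.* D) ⊎ ¬ (p ∣ 4 ℕ.* (X ℕ.* Y)) → ¬ (discriminant α β γ δ ≈ 0#)
    discriminant≉0 p∤ disc≈0 = nonzero-* (nonzero-* σ≉0 σ≉0) (nonzero-* (nonzero-* T≉0 T≉0) inner≉0)
      (trans (sym discriminant≈) disc≈0)
      where
      inner≉0 : ¬ (cast K (D ℕ.* D) + s * cast K (4 ℕ.* (X ℕ.* Y)) ≈ 0#)
      inner≉0 = Eq.subst (λ e → ¬ (cast K (D ℕ.* D) + pow K t e * cast K (4 ℕ.* (X ℕ.* Y)) ≈ 0#)) (Eq.sym m≡a+1+u)
                  (binomial-nonzero (suc b ℕ.+ u) (D ℕ.* D) (4 ℕ.* (X ℕ.* Y)) p∤)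

    γ≈0 : p ∣ Y → γ ≈ 0#
    γ≈0 p∣Y = trans γ≈ (trans (-‿cong (*-congˡ (*-congˡ (cast-multiple p∣Y)))) (solve 2 (λ x g → :- (x :* (g :* O)) := O) refl T σ))

    β≈0 : p ∣ X → β ≈ 0#
    β≈0 p∣X = trans β≈ (trans (-‿cong (*-congˡ (*-congˡ (cast-multiple p∣X)))) (solve 3 (λ x y g → :- ((x :* y) :* (g :* O)) := O) refl T s σ))

    γ≉0 : ¬ (p ∣ Y) → ¬ (γ ≈ 0#)
    γ≉0 p∤Y γ≈0 = nonzero-neg (nonzero-* T≉0 (nonzero-* σ≉0 (cast-nonmultiple p∤Y))) (trans (sym γ≈) γ≈0)

    α-δ≉0 : ¬ (p ∣ D) → ¬ (α - δ ≈ 0#)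
    α-δ≉0 p∤D α-δ≈0 = nonzero-neg (nonzero-* (nonzero-* σ≉0 T≉0) (cast-nonmultiple p∤D))
      (trans (sym (trans (+-cong α≈ (trans (-‿cong δ≈) -0#≈0#)) (+-identityʳ _))) α-δ≈0)

    block-diagonalization : BlockDiagonalization a (block E a)
    block-diagonalization = blockDiagonalization-cong (matrix₂-entries (block E a)) by-cases
      where
      by-cases : BlockDiagonalization a (matrix₂ α β γ δ)
      by-cases with p ∣? X | p ∣? Y
      ... | yes p∣X | yes p∣Y = diagonal-block α β γ δ (β≈0 p∣X) (γ≈0 p∣Y)
      ... | no p∤X | yes p∣Y = triangular-block α β γ δ (γ≈0 p∣Y) (α-δ≉0 p∤D)
        where
        p∤D : ¬ (p ∣ D)
        p∤D p∣D = p∤X (∣m+n∣m⇒∣n (Eq.subst (p ∣_) (Eq.trans (Eq.sym pascal) (ℕP.+-comm X D)) p∣Y) p∣D)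
      ... | _ | no p∤Y with p ∣? D
      ...   | no p∤D = generic-block α β γ δ (γ≉0 p∤Y) (discriminant≉0 (inj₁ (prime∤-* pp p∤D p∤D)))
      ...   | yes p∣D = generic-block α β γ δ (γ≉0 p∤Y) (discriminant≉0 (inj₂ (prime∤-* pp (odd-prime∤4 pp p≢2) (prime∤-* pp p∤X p∤Y))))
        where
        p∤X : ¬ (p ∣ X)
        p∤X p∣X = p∤Y (Eq.subst (p ∣_) pascal (∣m∣n⇒∣m+n p∣X p∣D))

  class-block : ∀ c → c ℕ.< m → BlockDiagonalization c (block E c)
  class-block zero _ = class₀-block
  class-block (suc b) b+1<m = ClassBlock.block-diagonalization b (m ℕ.∸ suc (suc b)) (Eq.sym (ℕP.m+[n∸m]≡n b+1<m))

  U_t-diagonalizable : Diagonalizable K (UtMatrix K q (2 ℕ.* q) t)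
  U_t-diagonalizable = blockwise-diagonalizable E E-across-classes class-block

open import Data.Nat using (_*_; _^_)
open ArithmeticFacts using (prime∤1; odd-suc⇒even; odd-primePower; prime∣binom-primePower)

-- Here q ≥ 2, m = q - 1 is even since q is odd, and p divides C(q, v) for 0 < v < q.
theorem4p4 : (p r q : ℕ) → Prime p → p ≢ 2 → q ≡ p ^ suc r →
    {c ℓ : Level} (K : CommutativeRing c ℓ) →
    IsField K → IsAlgClosed K →
    CommutativeRing._≈_ K (cast K p) (CommutativeRing.0# K) →
    (t : CommutativeRing.Carrier K) → TranscendentalOverFp K p t →
    Diagonalizable K (UtMatrix K q (2 * q) t)
theorem4p4 p r zero pp p≢2 q≡pʳ⁺¹ K fld acl cast-p t t-transc =
  contradiction (Eq.sym q≡pʳ⁺¹) (ℕ.≢-nonZero⁻¹ (p ^ suc r) {{ℕP.m^n≢0 p (suc r) {{prime⇒nonZero pp}}}})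
theorem4p4 p r (suc zero) pp p≢2 q≡pʳ⁺¹ K fld acl cast-p t t-transc =
  contradiction (divides (p ^ r) (Eq.trans q≡pʳ⁺¹ (ℕP.*-comm p (p ^ r)))) (prime∤1 pp)
theorem4p4 p r (suc (suc m)) pp p≢2 q≡pʳ⁺¹ K fld acl cast-p t t-transc
  with odd-suc⇒even (suc m) (λ 2∣q → odd-primePower pp p≢2 (suc r) (Eq.subst (2 ∣_) q≡pʳ⁺¹ 2∣q))
... | h , m≡h+h = AtkinMatrix.U_t-diagonalizable K fld acl p pp p≢2 cast-p t t-transc (suc m) h m≡h+h p∣binom-q
  where
  p∣binom-q : ∀ v → 0 ℕ.< v → v ℕ.< suc (suc m) → p ∣ suc (suc m) C v
  p∣binom-q v 0<v v<q = Eq.subst (λ x → p ∣ x C v) (Eq.sym q≡pʳ⁺¹)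
    (prime∣binom-primePower pp r v 0<v (Eq.subst (v ℕ.<_) q≡pʳ⁺¹ v<q))
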